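{- Let $k$, $r$ and $d$ be positive integers with $d \ge 2$, and let $G$ be a graph on $n = |V(G)|$ vertices with minimum degree at least $d$ and girth at least $2k+1$. Then $$\gamma^{t}_{(k,r)}(G) \leq \frac{2nr}{(d-1)^k} + n r e^{ -r/4}.$$
   Context: For a graph $G$ and vertices $u,v$, $d(u,v)$ denotes the length of a shortest path between $u$ and $v$. For $v \in V(G)$, $N_k(v) = \{u \in V(G) : u \neq v,\ d(u,v) \le k\}$. A set $S \subseteq V(G)$ is a total $(k,r)$-dominating set of $G$ if for every vertex $u \in V(G)$, $|N_k(u) \cap S| \ge r$, i.e. every vertex is within distance $k$ of at least $r$ vertices of $S$ other than itself. The total $(k,r)$-domination number $\gamma^{t}_{(k,r)}(G)$ is the minimum cardinality of a total $(k,r)$-dominating set of $G$. The girth of $G$ is the length of a shortest cycle in $G$. -}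

module Defs where

open import Data.Nat as ℕ using (ℕ; zero; suc; _≤_; _≥_)
open import Data.Integer using (+_)
open import Data.Fin using (Fin)
open import Data.Fin.Subset using (Subset; _∈_; ∣_∣)
open import Data.List using (List; []; _∷_; _++_; [_]; length)
open import Data.List.Relation.Unary.All using (All)
open import Data.List.Relation.Unary.Linked using (Linked)
open import Data.List.Relation.Unary.Unique.Propositional using (Unique)
open import Data.Product using (Σ; ∃; _×_; _,_)
open import Data.Rational as ℚ using (ℚ; _/_)
open import Relation.Binary.PropositionalEquality using (_≡_; _≢_)
open import Relation.Nullary using (¬_)
open import Level using (0ℓ)

-- A finite simple graph on the vertex set Fin n (undirected, loopless;
-- as a relation, so there are no multiple edges).
record Graph (n : ℕ) : Set₁ where
  field
    Adj    : Fin n → Fin n → Set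
    sym    : ∀ {u v} → Adj u v → Adj v u
    irrefl : ∀ {u} → ¬ Adj u u
open Graph public

module _ {n : ℕ} (G : Graph n) where

  data Walk : Fin n → Fin n → ℕ → Set where
    here : ∀ {u} → Walk u u 0
    step : ∀ {u v w l} → Adj G u v → Walk v w l → Walk u w (suc l)

  DistLe : Fin n → Fin n → ℕ → Set
  DistLe u v k = ∃ λ l → l ≤ k × Walk u v l

  -- u ∈ N_k(v)  :  u ≠ v and d(u,v) ≤ k
  InN : ℕ → Fin n → Fin n → Set
  InN k v u = u ≢ v × DistLe u v k

  AtLeast : ℕ → (Fin n → Set) → Set
  AtLeast r P = ∃ λ (xs : List (Fin n)) → length xs ≡ r × Unique xs × All P xs

  MinDegGe : ℕ → Set
  MinDegGe d = ∀ v → AtLeast d (Adj G v)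

  HasCycle : ℕ → Set
  HasCycle m = Σ (Fin n) λ x → Σ (List (Fin n)) λ xs →
    length (x ∷ xs) ≡ m × 3 ≤ m × Unique (x ∷ xs) × Linked (Adj G) (x ∷ xs ++ [ x ])

  -- girth(G) ≥ g  (acyclic graphs have girth ∞)
  GirthGe : ℕ → Set
  GirthGe g = ∀ m → HasCycle m → g ≤ m

  IsTotalDom : ℕ → ℕ → Subset n → Set
  IsTotalDom k r S = ∀ u → AtLeast r (λ v → v ∈ S × InN k u v)

toℚ : ℕ → ℚ
toℚ m = + m / 1

expTerm : ℚ → ℕ → ℚ
expTerm t zero = ℚ.1ℚ
expTerm t (suc j) = expTerm t j ℚ.* t ℚ.* (+ 1 / suc j)

-- partial sums  S_N(t) = Σ_{j=0}^{N} t^j / j!   (S_N(t) → e^t)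
expPartial : ℚ → ℕ → ℚ
expPartial t zero = expTerm t zero
expPartial t (suc N) = expPartial t N ℚ.+ expTerm t (suc N)

-- For rationals a, b, c ≥ 0 and t ≥ 0, the real inequality
--   a ≤ b + c · e^{-t}
-- holds iff (a - b) · e^t ≤ c iff (a - b) · S_N(t) ≤ c for every N
-- (the partial sums S_N(t) are positive and increase to e^t).
LeExpBound : (a b c t : ℚ) → Set
LeExpBound a b c t = ∀ (N : ℕ) → (a ℚ.- b) ℚ.* expPartial t N ℚ.≤ c

-- a / b as a rational (only used with b ≠ 0; the value at b = 0 is junk 0)
frac : ℕ → ℕ → ℚ
frac a zero = ℚ.0ℚ
frac a (suc b) = + a / suc b

module Submission where

-- Minimum degree ≥ d and girth ≥ 2k + 1 make (d - 1)^k non-backtracking walks of length k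
-- from any vertex v end at distinct vertices of N_k(v): two of them with the same end would
-- close a cycle of length ≤ 2k.  With m = (d - 1)^k > 2r, pick T ⊆ V(G) at random, each vertex
-- independently with probability p = 2r/m, and add the r dominators of the given total
-- dominating set for every v with |T ∩ N_k(v)| < r.  By Markov's inequality for 2^-|T ∩ N_k(v)|
-- this happens with probability at most 2^r (1 - p/2)^m ≤ 2^r e^-r ≤ e^-(r/4), so the expected
-- size is at most 2nr/m + nr e^-(r/4); the random choice is replaced by averaging over all T with
-- weights (2r)^|T| (m - 2r)^(n - |T|).  Since e^x is only available through its partial sums
-- S_N(x), these are bounded by (1 - y)^-s from above and by (1 + z)^L from below.  When
-- m ≤ 2r the whole vertex set already satisfies the bound.

open import Data.Nat as ℕ using (ℕ)
open import Data.Fin.Subset using (Subset)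
open import Defs using (Graph; Adj; irrefl; Walk; HasCycle; GirthGe; InN; AtLeast; MinDegGe; IsTotalDom; toℚ; expTerm; expPartial; frac; LeExpBound)

module Rationals where

  open import Data.Nat as ℕ using (ℕ; zero; suc; z≤n)
  open import Data.Integer as ℤ using (+_; +≤+)
  import Data.Integer.Properties as ℤP
  open import Data.Rational as ℚ using (ℚ; 0ℚ; 1ℚ; _/_; _+_; _*_; _-_; _≤_; _<_; toℚᵘ)
  import Data.Rational.Properties as ℚP
  open import Data.Rational.Unnormalised as ℚᵘ using (mkℚᵘ; *≡*; *≤*)
  import Data.Rational.Unnormalised.Properties as ℚᵘP
  open import Algebra.Bundles using (CommutativeRing)
  open import Algebra.Properties.CommutativeSemiring.Exp
    (CommutativeRing.commutativeSemiring ℚP.+-*-commutativeRing) public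
    using (_^_; ^-distrib-*; ^-assocʳ)
  open import Data.Rational.Solver using (module +-*-Solver)
  open +-*-Solver using (solve; _:+_; _:-_; _:=_)
  open import Relation.Binary.PropositionalEquality
  import Data.Nat.Properties as ℕP

  toℚᵘ-toℚ : ∀ a → toℚᵘ (toℚ a) ℚᵘ.≃ mkℚᵘ (+ a) 0
  toℚᵘ-toℚ a = ℚP.toℚᵘ-fromℚᵘ (mkℚᵘ (+ a) 0)

  toℚ-+ : ∀ a b → toℚ (a ℕ.+ b) ≡ toℚ a + toℚ b
  toℚ-+ a b = ℚP.toℚᵘ-injective (begin
    toℚᵘ (toℚ (a ℕ.+ b))               ≈⟨ toℚᵘ-toℚ (a ℕ.+ b) ⟩
    mkℚᵘ (+ (a ℕ.+ b)) 0               ≈⟨ *≡* (cong (ℤ._* + 1) (trans (cong₂ ℤ._+_ (ℤP.*-identityʳ (+ a)) (ℤP.*-identityʳ (+ b))) (sym (ℤP.pos-+ a b)))) ⟨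
    mkℚᵘ (+ a) 0 ℚᵘ.+ mkℚᵘ (+ b) 0     ≈⟨ ℚᵘP.+-cong (toℚᵘ-toℚ a) (toℚᵘ-toℚ b) ⟨
    toℚᵘ (toℚ a) ℚᵘ.+ toℚᵘ (toℚ b)     ≈⟨ ℚP.toℚᵘ-homo-+ (toℚ a) (toℚ b) ⟨
    toℚᵘ (toℚ a + toℚ b)               ∎)
    where open ℚᵘP.≃-Reasoning

  toℚ-* : ∀ a b → toℚ (a ℕ.* b) ≡ toℚ a * toℚ b
  toℚ-* a b = ℚP.toℚᵘ-injective (begin
    toℚᵘ (toℚ (a ℕ.* b))               ≈⟨ toℚᵘ-toℚ (a ℕ.* b) ⟩
    mkℚᵘ (+ (a ℕ.* b)) 0               ≈⟨ *≡* (cong (ℤ._* + 1) (sym (ℤP.pos-* a b))) ⟨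
    mkℚᵘ (+ a) 0 ℚᵘ.* mkℚᵘ (+ b) 0     ≈⟨ ℚᵘP.*-cong (toℚᵘ-toℚ a) (toℚᵘ-toℚ b) ⟨
    toℚᵘ (toℚ a) ℚᵘ.* toℚᵘ (toℚ b)     ≈⟨ ℚP.toℚᵘ-homo-* (toℚ a) (toℚ b) ⟨
    toℚᵘ (toℚ a * toℚ b)               ∎)
    where open ℚᵘP.≃-Reasoning

  toℚ-^ : ∀ a j → toℚ (a ℕ.^ j) ≡ toℚ a ^ j
  toℚ-^ a zero    = refl
  toℚ-^ a (suc j) = trans (toℚ-* a (a ℕ.^ j)) (cong (toℚ a *_) (toℚ-^ a j))

  toℚ-mono-≤ : ∀ {a b} → a ℕ.≤ b → toℚ a ≤ toℚ b
  toℚ-mono-≤ {a} {b} a≤b = ℚP.toℚᵘ-cancel-≤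
    (ℚᵘP.≤-respʳ-≃ (ℚᵘP.≃-sym (toℚᵘ-toℚ b)) (ℚᵘP.≤-respˡ-≃ (ℚᵘP.≃-sym (toℚᵘ-toℚ a))
      (*≤* (ℤP.*-monoʳ-≤-nonNeg (+ 1) (+≤+ a≤b)))))

  toℚ-nonNeg : ∀ a → 0ℚ ≤ toℚ a
  toℚ-nonNeg a = toℚ-mono-≤ (z≤n {a})

  toℚ-pos : ∀ {a} → 0 ℕ.< a → 0ℚ < toℚ a
  toℚ-pos {suc a} _ = ℚP.positive⁻¹ (toℚ (suc a)) {{ℚP.normalize-pos (suc a) 1}}

  toℚ*1/toℚ : ∀ b → toℚ (suc b) * (+ 1 / suc b) ≡ 1ℚ
  toℚ*1/toℚ b = ℚP.toℚᵘ-injective (begin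
    toℚᵘ (toℚ (suc b) * (+ 1 / suc b))               ≈⟨ ℚP.toℚᵘ-homo-* (toℚ (suc b)) (+ 1 / suc b) ⟩
    toℚᵘ (toℚ (suc b)) ℚᵘ.* toℚᵘ (+ 1 / suc b)       ≈⟨ ℚᵘP.*-cong (toℚᵘ-toℚ (suc b)) (ℚP.toℚᵘ-fromℚᵘ (mkℚᵘ (+ 1) b)) ⟩
    mkℚᵘ (+ suc b) 0 ℚᵘ.* mkℚᵘ (+ 1) b               ≈⟨ *≡* (trans (ℤP.*-identityʳ (+ (suc b ℕ.* 1))) (trans (cong +_ (ℕP.*-comm (suc b) 1)) (sym (ℤP.*-identityˡ (+ (1 ℕ.* suc b)))))) ⟩
    toℚᵘ 1ℚ                                          ∎)
    where open ℚᵘP.≃-Reasoning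

  /≡toℚ*1/ : ∀ a b → + a / suc b ≡ toℚ a * (+ 1 / suc b)
  /≡toℚ*1/ a b = ℚP.toℚᵘ-injective (begin
    toℚᵘ (+ a / suc b)                               ≈⟨ ℚP.toℚᵘ-fromℚᵘ (mkℚᵘ (+ a) b) ⟩
    mkℚᵘ (+ a) b                                     ≈⟨ *≡* (cong₂ ℤ._*_ (ℤP.*-identityʳ (+ a)) (cong +_ (sym (ℕP.*-identityˡ (suc b))))) ⟨
    mkℚᵘ (+ a) 0 ℚᵘ.* mkℚᵘ (+ 1) b                   ≈⟨ ℚᵘP.*-cong (toℚᵘ-toℚ a) (ℚP.toℚᵘ-fromℚᵘ (mkℚᵘ (+ 1) b)) ⟨
    toℚᵘ (toℚ a) ℚᵘ.* toℚᵘ (+ 1 / suc b)             ≈⟨ ℚP.toℚᵘ-homo-* (toℚ a) (+ 1 / suc b) ⟨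
    toℚᵘ (toℚ a * (+ 1 / suc b))                     ∎)
    where open ℚᵘP.≃-Reasoning

  *-nonNeg : ∀ {p q} → 0ℚ ≤ p → 0ℚ ≤ q → 0ℚ ≤ p * q
  *-nonNeg {p} {q} 0≤p 0≤q =
    ℚP.nonNegative⁻¹ (p * q) {{ℚP.nonNeg*nonNeg⇒nonNeg p {{ℚ.nonNegative 0≤p}} q {{ℚ.nonNegative 0≤q}}}}

  *-monoˡ-≤-nonNeg′ : ∀ {p q} r → 0ℚ ≤ r → p ≤ q → r * p ≤ r * q
  *-monoˡ-≤-nonNeg′ r 0≤r = ℚP.*-monoˡ-≤-nonNeg r {{ℚ.nonNegative 0≤r}}

  *-monoʳ-≤-nonNeg′ : ∀ {p q} r → 0ℚ ≤ r → p ≤ q → p * r ≤ q * r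
  *-monoʳ-≤-nonNeg′ r 0≤r = ℚP.*-monoʳ-≤-nonNeg r {{ℚ.nonNegative 0≤r}}

  *-mono-≤-nonNeg′ : ∀ {p q r s} → 0ℚ ≤ q → 0ℚ ≤ r → p ≤ q → r ≤ s → p * r ≤ q * s
  *-mono-≤-nonNeg′ {q = q} {r = r} 0≤q 0≤r p≤q r≤s =
    ℚP.≤-trans (*-monoʳ-≤-nonNeg′ r 0≤r p≤q) (*-monoˡ-≤-nonNeg′ _ 0≤q r≤s)

  *-cancelˡ-≤-pos′ : ∀ {p q} r → 0ℚ < r → r * p ≤ r * q → p ≤ q
  *-cancelˡ-≤-pos′ r 0<r = ℚP.*-cancelˡ-≤-pos r {{ℚ.positive 0<r}}

  p≤q⇒0≤q-p : ∀ {p q} → p ≤ q → 0ℚ ≤ q - p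
  p≤q⇒0≤q-p {p} p≤q = ℚP.≤-trans (ℚP.≤-reflexive (sym (ℚP.+-inverseʳ p))) (ℚP.+-monoˡ-≤ (ℚ.- p) p≤q)

  p≤q⇒p-q≤0 : ∀ {p q} → p ≤ q → p - q ≤ 0ℚ
  p≤q⇒p-q≤0 {q = q} p≤q = ℚP.≤-trans (ℚP.+-monoˡ-≤ (ℚ.- q) p≤q) (ℚP.≤-reflexive (ℚP.+-inverseʳ q))

  p≤p+q : ∀ p {q} → 0ℚ ≤ q → p ≤ p + q
  p≤p+q p 0≤q = ℚP.≤-trans (ℚP.≤-reflexive (sym (ℚP.+-identityʳ p))) (ℚP.+-monoʳ-≤ p 0≤q)

  p-q≤p : ∀ p {q} → 0ℚ ≤ q → p - q ≤ p
  p-q≤p p 0≤q = ℚP.≤-trans (ℚP.+-monoʳ-≤ p (ℚP.neg-antimono-≤ 0≤q)) (ℚP.≤-reflexive (ℚP.+-identityʳ p))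

  ^-nonNeg : ∀ {p} j → 0ℚ ≤ p → 0ℚ ≤ p ^ j
  ^-nonNeg zero    _   = toℚ-nonNeg 1
  ^-nonNeg (suc j) 0≤p = *-nonNeg 0≤p (^-nonNeg j 0≤p)

  ^-monoˡ-≤ : ∀ {p q} j → 0ℚ ≤ p → p ≤ q → p ^ j ≤ q ^ j
  ^-monoˡ-≤ zero    _   _   = ℚP.≤-refl
  ^-monoˡ-≤ (suc j) 0≤p p≤q =
    *-mono-≤-nonNeg′ (ℚP.≤-trans 0≤p p≤q) (^-nonNeg j 0≤p) p≤q (^-monoˡ-≤ j 0≤p p≤q)

  toℚ-∸ : ∀ {a b} → b ℕ.≤ a → toℚ (a ℕ.∸ b) ≡ toℚ a - toℚ b
  toℚ-∸ {a} {b} b≤a = begin-equality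
    toℚ (a ℕ.∸ b)                    ≡⟨ solve 2 (λ x y → x := x :+ y :- y) refl (toℚ (a ℕ.∸ b)) (toℚ b) ⟩
    toℚ (a ℕ.∸ b) + toℚ b - toℚ b    ≡⟨ cong (_- toℚ b) (toℚ-+ (a ℕ.∸ b) b) ⟨
    toℚ (a ℕ.∸ b ℕ.+ b) - toℚ b      ≡⟨ cong (λ c → toℚ c - toℚ b) (ℕP.m∸n+n≡m b≤a) ⟩
    toℚ a - toℚ b                    ∎
    where open ℚP.≤-Reasoning

  toℚ-≤-+⇒-≤ : ∀ {x y z} → x ℕ.≤ y ℕ.+ z → toℚ x - toℚ y ≤ toℚ z
  toℚ-≤-+⇒-≤ {x} {y} {z} x≤y+z = begin
    toℚ x - toℚ y              ≤⟨ ℚP.+-monoˡ-≤ (ℚ.- toℚ y) (toℚ-mono-≤ x≤y+z) ⟩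
    toℚ (y ℕ.+ z) - toℚ y      ≡⟨ cong (_- toℚ y) (toℚ-+ y z) ⟩
    toℚ y + toℚ z - toℚ y      ≡⟨ solve 2 (λ y z → y :+ z :- y := z) refl (toℚ y) (toℚ z) ⟩
    toℚ z                      ∎
    where open ℚP.≤-Reasoning

  /-nonNeg : ∀ a b → 0ℚ ≤ + a / suc b
  /-nonNeg a b = ℚP.nonNegative⁻¹ (+ a / suc b) {{ℚP.normalize-nonNeg a (suc b)}}

  toℚ*/≡toℚ : ∀ a b → toℚ (suc b) * (+ a / suc b) ≡ toℚ a
  toℚ*/≡toℚ a b = begin-equality
    toℚ (suc b) * (+ a / suc b)             ≡⟨ cong (toℚ (suc b) *_) (/≡toℚ*1/ a b) ⟩
    toℚ (suc b) * (toℚ a * (+ 1 / suc b))   ≡⟨ ℚP.*-comm (toℚ (suc b)) _ ⟩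
    toℚ a * (+ 1 / suc b) * toℚ (suc b)     ≡⟨ ℚP.*-assoc (toℚ a) _ _ ⟩
    toℚ a * ((+ 1 / suc b) * toℚ (suc b))   ≡⟨ cong (toℚ a *_) (trans (ℚP.*-comm _ (toℚ (suc b))) (toℚ*1/toℚ b)) ⟩
    toℚ a * 1ℚ                              ≡⟨ ℚP.*-identityʳ (toℚ a) ⟩
    toℚ a                                   ∎
    where open ℚP.≤-Reasoning

  /≤1 : ∀ {a b} → a ℕ.≤ suc b → + a / suc b ≤ 1ℚ
  /≤1 {a} {b} a≤b = begin
    + a / suc b                     ≡⟨ /≡toℚ*1/ a b ⟩
    toℚ a * (+ 1 / suc b)           ≤⟨ *-monoʳ-≤-nonNeg′ _ (/-nonNeg 1 b) (toℚ-mono-≤ a≤b) ⟩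
    toℚ (suc b) * (+ 1 / suc b)     ≡⟨ toℚ*1/toℚ b ⟩
    1ℚ                              ∎
    where open ℚP.≤-Reasoning

module Multichoose where

  open import Data.Nat using (ℕ; zero; suc; _+_; _*_; _^_; _≤_; _!)
  open import Data.Nat.Properties
  open import Data.Nat.Solver using (module +-*-Solver)
  open +-*-Solver using (solve; _:+_; _:*_; con; _:=_)
  open import Relation.Binary.PropositionalEquality using (_≡_; refl; sym; trans; cong; cong₂)
  open ≤-Reasoning

  multichoose : ℕ → ℕ → ℕ
  multichoose zero    zero    = 1
  multichoose zero    (suc j) = 0
  multichoose (suc s) zero    = 1
  multichoose (suc s) (suc j) = multichoose (suc s) j + multichoose s (suc j)

  multichoose-zero : ∀ s → multichoose s 0 ≡ 1
  multichoose-zero zero    = refl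
  multichoose-zero (suc s) = refl

  risingFactorial : ℕ → ℕ → ℕ
  risingFactorial s zero    = 1
  risingFactorial s (suc j) = risingFactorial s j * (s + j)

  risingFactorial-suc : ∀ s j → risingFactorial s (suc j) ≡ s * risingFactorial (suc s) j
  risingFactorial-suc s zero    = trans (*-identityˡ (s + 0)) (trans (+-identityʳ s) (sym (*-identityʳ s)))
  risingFactorial-suc s (suc j) = begin-equality
    risingFactorial s (suc j) * (s + suc j)         ≡⟨ cong₂ _*_ (risingFactorial-suc s j) (+-suc s j) ⟩
    s * risingFactorial (suc s) j * (suc s + j)     ≡⟨ *-assoc s _ _ ⟩
    s * risingFactorial (suc s) (suc j)             ∎

  !*multichoose≡risingFactorial : ∀ s j → j ! * multichoose s j ≡ risingFactorial s j
  !*multichoose≡risingFactorial zero    zero    = refl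
  !*multichoose≡risingFactorial zero    (suc j) = trans (*-zeroʳ (suc j !)) (sym (risingFactorial-suc 0 j))
  !*multichoose≡risingFactorial (suc s) zero    = refl
  !*multichoose≡risingFactorial (suc s) (suc j) = begin-equality
    suc j ! * (multichoose (suc s) j + multichoose s (suc j))
      ≡⟨ solve 4 (λ j f a b → (con 1 :+ j) :* f :* (a :+ b) := (con 1 :+ j) :* (f :* a) :+ (con 1 :+ j) :* f :* b) refl j (j !) (multichoose (suc s) j) (multichoose s (suc j)) ⟩
    suc j * (j ! * multichoose (suc s) j) + suc j ! * multichoose s (suc j)
      ≡⟨ cong₂ (λ p q → suc j * p + q) (!*multichoose≡risingFactorial (suc s) j) (!*multichoose≡risingFactorial s (suc j)) ⟩
    suc j * risingFactorial (suc s) j + risingFactorial s (suc j)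
      ≡⟨ cong (suc j * risingFactorial (suc s) j +_) (risingFactorial-suc s j) ⟩
    suc j * risingFactorial (suc s) j + s * risingFactorial (suc s) j
      ≡⟨ solve 3 (λ j r s → (con 1 :+ j) :* r :+ s :* r := r :* (con 1 :+ s :+ j)) refl j (risingFactorial (suc s) j) s ⟩
    risingFactorial (suc s) (suc j) ∎

  ^≤risingFactorial : ∀ s j → s ^ j ≤ risingFactorial s j
  ^≤risingFactorial s zero    = ≤-refl
  ^≤risingFactorial s (suc j) = begin
    s * s ^ j                       ≤⟨ *-mono-≤ (m≤m+n s j) (^≤risingFactorial s j) ⟩
    (s + j) * risingFactorial s j   ≡⟨ *-comm (s + j) _ ⟩
    risingFactorial s (suc j)       ∎

  ^≤!*multichoose : ∀ s j → s ^ j ≤ j ! * multichoose s j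
  ^≤!*multichoose s j = begin
    s ^ j                  ≤⟨ ^≤risingFactorial s j ⟩
    risingFactorial s j    ≡⟨ !*multichoose≡risingFactorial s j ⟨
    j ! * multichoose s j  ∎

module ExponentialSeries where

  open Rationals
  open import Data.Nat as ℕ using (ℕ; zero; suc; _!)
  import Data.Nat.Properties as ℕP
  open import Data.Integer using (+_)
  open import Data.Rational as ℚ using (ℚ; 0ℚ; 1ℚ; _/_; _+_; _*_; _-_; _≤_)
  import Data.Rational.Properties as ℚP
  open import Data.Rational.Solver using (module +-*-Solver)
  open +-*-Solver using (solve; _:+_; _:*_; _:-_; con; _:=_)
  open import Relation.Binary.PropositionalEquality using (_≡_; refl; sym; trans; cong; cong₂; subst)
  open import Relation.Nullary.Decidable using (from-yes)
  open Multichoose using (multichoose; multichoose-zero; ^≤!*multichoose)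
  open ℚP.≤-Reasoning

  expTerm*! : ∀ t j → expTerm t j * toℚ (j !) ≡ t ^ j
  expTerm*! t zero    = ℚP.*-identityˡ 1ℚ
  expTerm*! t (suc j) = begin-equality
    expTerm t j * t * i * toℚ (suc j ℕ.* j !)      ≡⟨ cong (expTerm t j * t * i *_) (toℚ-* (suc j) (j !)) ⟩
    expTerm t j * t * i * (toℚ (suc j) * toℚ (j !)) ≡⟨ solve 5 (λ e t i s f → e :* t :* i :* (s :* f) := t :* (e :* f) :* (s :* i)) refl (expTerm t j) t i (toℚ (suc j)) (toℚ (j !)) ⟩
    t * (expTerm t j * toℚ (j !)) * (toℚ (suc j) * i) ≡⟨ cong₂ (λ p q → t * p * q) (expTerm*! t j) (toℚ*1/toℚ j) ⟩
    t * t ^ j * 1ℚ                                  ≡⟨ ℚP.*-identityʳ (t * t ^ j) ⟩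
    t ^ suc j                                       ∎
    where i = + 1 / suc j

  expTerm-nonNeg : ∀ {t} j → 0ℚ ≤ t → 0ℚ ≤ expTerm t j
  expTerm-nonNeg zero    _   = toℚ-nonNeg 1
  expTerm-nonNeg (suc j) 0≤t = *-nonNeg (*-nonNeg (expTerm-nonNeg j 0≤t) 0≤t) (/-nonNeg 1 j)

  expPartial-nonNeg : ∀ {t} N → 0ℚ ≤ t → 0ℚ ≤ expPartial t N
  expPartial-nonNeg zero    _   = toℚ-nonNeg 1
  expPartial-nonNeg (suc N) 0≤t = ℚP.+-mono-≤ (expPartial-nonNeg N 0≤t) (expTerm-nonNeg (suc N) 0≤t)

  expPartial-≤-suc : ∀ {t} N → 0ℚ ≤ t → expPartial t N ≤ expPartial t (suc N)
  expPartial-≤-suc {t} N 0≤t = begin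
    expPartial t N       ≡⟨ ℚP.+-identityʳ (expPartial t N) ⟨
    expPartial t N + 0ℚ  ≤⟨ ℚP.+-monoʳ-≤ (expPartial t N) (expTerm-nonNeg (suc N) 0≤t) ⟩
    expPartial t (suc N) ∎

  -- the partial sums of the binomial series (1 - y)^-s = Σ_j multichoose s j · y^j
  negBinomialPartial : ℕ → ℚ → ℕ → ℚ
  negBinomialPartial s y zero    = toℚ (multichoose s 0)
  negBinomialPartial s y (suc N) = negBinomialPartial s y N + toℚ (multichoose s (suc N)) * y ^ suc N

  negBinomialPartial-zero : ∀ y N → negBinomialPartial 0 y N ≡ 1ℚ
  negBinomialPartial-zero y zero    = refl
  negBinomialPartial-zero y (suc N) = trans (cong (_+ 0ℚ * y ^ suc N) (negBinomialPartial-zero y N))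
    (solve 1 (λ p → con 1ℚ :+ con 0ℚ :* p := con 1ℚ) refl (y ^ suc N))

  [1-y]*negBinomialPartial : ∀ s y N →
    (1ℚ - y) * negBinomialPartial (suc s) y N ≡ negBinomialPartial s y N - toℚ (multichoose (suc s) N) * y ^ suc N
  [1-y]*negBinomialPartial s y zero rewrite multichoose-zero s =
    solve 1 (λ y → (con 1ℚ :- y) :* con 1ℚ := con 1ℚ :- con 1ℚ :* (y :* con 1ℚ)) refl y
  [1-y]*negBinomialPartial s y (suc N) = begin-equality
    (1ℚ - y) * (A + toℚ (multichoose (suc s) N ℕ.+ multichoose s (suc N)) * P)
      ≡⟨ cong (λ c → (1ℚ - y) * (A + c * P)) (toℚ-+ (multichoose (suc s) N) _) ⟩
    (1ℚ - y) * (A + (c₁ + c₂) * P)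
      ≡⟨ solve 5 (λ y A c₁ c₂ P → (con 1ℚ :- y) :* (A :+ (c₁ :+ c₂) :* P) := (con 1ℚ :- y) :* A :+ (con 1ℚ :- y) :* (c₁ :+ c₂) :* P) refl y A c₁ c₂ P ⟩
    (1ℚ - y) * A + (1ℚ - y) * (c₁ + c₂) * P
      ≡⟨ cong (_+ (1ℚ - y) * (c₁ + c₂) * P) ([1-y]*negBinomialPartial s y N) ⟩
    (B - c₁ * P) + (1ℚ - y) * (c₁ + c₂) * P
      ≡⟨ solve 5 (λ y B c₁ c₂ P → (B :- c₁ :* P) :+ (con 1ℚ :- y) :* (c₁ :+ c₂) :* P := (B :+ c₂ :* P) :- (c₁ :+ c₂) :* (y :* P)) refl y B c₁ c₂ P ⟩
    (B + c₂ * P) - (c₁ + c₂) * (y * P)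
      ≡⟨ cong (λ c → (B + c₂ * P) - c * (y * P)) (toℚ-+ (multichoose (suc s) N) _) ⟨
    (B + c₂ * P) - toℚ (multichoose (suc s) N ℕ.+ multichoose s (suc N)) * (y * P) ∎
    where
    A  = negBinomialPartial (suc s) y N
    B  = negBinomialPartial s y N
    P  = y ^ suc N
    c₁ = toℚ (multichoose (suc s) N)
    c₂ = toℚ (multichoose s (suc N))

  [1-y]^s*negBinomialPartial≤1 : ∀ s y N → 0ℚ ≤ y → y ≤ 1ℚ → (1ℚ - y) ^ s * negBinomialPartial s y N ≤ 1ℚ
  [1-y]^s*negBinomialPartial≤1 zero    y N _   _   = ℚP.≤-reflexive (trans (cong (1ℚ *_) (negBinomialPartial-zero y N)) (ℚP.*-identityˡ 1ℚ))
  [1-y]^s*negBinomialPartial≤1 (suc s) y N 0≤y y≤1 = begin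
    (1ℚ - y) * (1ℚ - y) ^ s * negBinomialPartial (suc s) y N
      ≡⟨ solve 3 (λ a b c → a :* b :* c := b :* (a :* c)) refl (1ℚ - y) ((1ℚ - y) ^ s) _ ⟩
    (1ℚ - y) ^ s * ((1ℚ - y) * negBinomialPartial (suc s) y N)
      ≡⟨ cong ((1ℚ - y) ^ s *_) ([1-y]*negBinomialPartial s y N) ⟩
    (1ℚ - y) ^ s * (negBinomialPartial s y N - toℚ (multichoose (suc s) N) * y ^ suc N)
      ≤⟨ *-monoˡ-≤-nonNeg′ _ (^-nonNeg s 0≤1-y) (p-q≤p _ (*-nonNeg (toℚ-nonNeg (multichoose (suc s) N)) (^-nonNeg (suc N) 0≤y))) ⟩
    (1ℚ - y) ^ s * negBinomialPartial s y N
      ≤⟨ [1-y]^s*negBinomialPartial≤1 s y N 0≤y y≤1 ⟩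
    1ℚ ∎
    where
    0≤1-y : 0ℚ ≤ 1ℚ - y
    0≤1-y = p≤q⇒0≤q-p y≤1

  expTerm≤multichoose : ∀ s y j → 0ℚ ≤ y → expTerm (toℚ s * y) j ≤ toℚ (multichoose s j) * y ^ j
  expTerm≤multichoose s y j 0≤y = *-cancelˡ-≤-pos′ (toℚ (j !)) (toℚ-pos {j !} (ℕP.1≤n! j)) (begin
    toℚ (j !) * expTerm (toℚ s * y) j              ≡⟨ trans (ℚP.*-comm (toℚ (j !)) _) (expTerm*! (toℚ s * y) j) ⟩
    (toℚ s * y) ^ j                                ≡⟨ trans (^-distrib-* (toℚ s) y j) (cong (_* y ^ j) (sym (toℚ-^ s j))) ⟩
    toℚ (s ℕ.^ j) * y ^ j                          ≤⟨ *-monoʳ-≤-nonNeg′ _ (^-nonNeg j 0≤y) (toℚ-mono-≤ (^≤!*multichoose s j)) ⟩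
    toℚ (j ! ℕ.* multichoose s j) * y ^ j          ≡⟨ trans (cong (_* y ^ j) (toℚ-* (j !) _)) (ℚP.*-assoc (toℚ (j !)) _ _) ⟩
    toℚ (j !) * (toℚ (multichoose s j) * y ^ j)    ∎)

  expPartial≤negBinomialPartial : ∀ s y N → 0ℚ ≤ y → expPartial (toℚ s * y) N ≤ negBinomialPartial s y N
  expPartial≤negBinomialPartial s y zero    _   = ℚP.≤-reflexive (cong toℚ (sym (multichoose-zero s)))
  expPartial≤negBinomialPartial s y (suc N) 0≤y =
    ℚP.+-mono-≤ (expPartial≤negBinomialPartial s y N 0≤y) (expTerm≤multichoose s y (suc N) 0≤y)

  [1-y]^s*expPartial≤1 : ∀ s y N → 0ℚ ≤ y → y ≤ 1ℚ → (1ℚ - y) ^ s * expPartial (toℚ s * y) N ≤ 1ℚ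
  [1-y]^s*expPartial≤1 s y N 0≤y y≤1 = ℚP.≤-trans
    (*-monoˡ-≤-nonNeg′ _ (^-nonNeg s (p≤q⇒0≤q-p y≤1)) (expPartial≤negBinomialPartial s y N 0≤y))
    ([1-y]^s*negBinomialPartial≤1 s y N 0≤y y≤1)

  bernoulli : ∀ {t z} j → 0ℚ ≤ t → 0ℚ ≤ z → t ^ suc j + toℚ (suc j) * z * t ^ j ≤ (t + z) ^ suc j
  bernoulli {t} {z} zero    _   _   =
    ℚP.≤-reflexive (solve 2 (λ t z → t :* con 1ℚ :+ con 1ℚ :* z :* con 1ℚ := (t :+ z) :* con 1ℚ) refl t z)
  bernoulli {t} {z} (suc j) 0≤t 0≤z = begin
    t * (t * B) + toℚ (suc (suc j)) * z * (t * B)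
      ≡⟨ cong (λ d → t * (t * B) + d * z * (t * B)) (toℚ-+ 1 (suc j)) ⟩
    t * (t * B) + (1ℚ + c) * z * (t * B)
      ≤⟨ p≤p+q _ (*-nonNeg (*-nonNeg (*-nonNeg (toℚ-nonNeg (suc j)) 0≤z) 0≤z) (^-nonNeg j 0≤t)) ⟩
    t * (t * B) + (1ℚ + c) * z * (t * B) + c * z * z * B
      ≡⟨ solve 4 (λ t z c B → t :* (t :* B) :+ (con 1ℚ :+ c) :* z :* (t :* B) :+ c :* z :* z :* B
                              := (t :+ z) :* (t :* B :+ c :* z :* B)) refl t z c B ⟩
    (t + z) * (t ^ suc j + c * z * B)
      ≤⟨ *-monoˡ-≤-nonNeg′ (t + z) (ℚP.+-mono-≤ 0≤t 0≤z) (bernoulli j 0≤t 0≤z) ⟩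
    (t + z) ^ suc (suc j) ∎
    where
    B = t ^ j
    c = toℚ (suc j)

  expTerm-suc+*expTerm≤ : ∀ {t z} j → 0ℚ ≤ t → 0ℚ ≤ z →
    expTerm t (suc j) + z * expTerm t j ≤ expTerm (t + z) (suc j)
  expTerm-suc+*expTerm≤ {t} {z} j 0≤t 0≤z = *-cancelˡ-≤-pos′ K (toℚ-pos {suc j !} (ℕP.1≤n! (suc j))) (begin
    K * (E₁ + z * E₀)                   ≡⟨ solve 4 (λ K E₁ z E₀ → K :* (E₁ :+ z :* E₀) := E₁ :* K :+ z :* (E₀ :* K)) refl K E₁ z E₀ ⟩
    E₁ * K + z * (E₀ * K)               ≡⟨ cong₂ (λ p q → p + z * q) (expTerm*! t (suc j)) E₀*K ⟩
    t ^ suc j + z * (c * t ^ j)         ≡⟨ cong (λ q → t ^ suc j + q) (solve 3 (λ z c B → z :* (c :* B) := c :* z :* B) refl z c (t ^ j)) ⟩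
    t ^ suc j + c * z * t ^ j           ≤⟨ bernoulli j 0≤t 0≤z ⟩
    (t + z) ^ suc j                     ≡⟨ trans (ℚP.*-comm K _) (expTerm*! (t + z) (suc j)) ⟨
    K * expTerm (t + z) (suc j)         ∎)
    where
    K  = toℚ (suc j !)
    c  = toℚ (suc j)
    E₀ = expTerm t j
    E₁ = expTerm t (suc j)
    E₀*K : E₀ * K ≡ c * t ^ j
    E₀*K = begin-equality
      E₀ * toℚ (suc j ℕ.* j !)          ≡⟨ cong (E₀ *_) (toℚ-* (suc j) (j !)) ⟩
      E₀ * (c * toℚ (j !))              ≡⟨ solve 3 (λ e c f → e :* (c :* f) := c :* (e :* f)) refl E₀ c (toℚ (j !)) ⟩
      c * (E₀ * toℚ (j !))              ≡⟨ cong (c *_) (expTerm*! t j) ⟩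
      c * t ^ j                         ∎

  expPartial-suc+*expPartial≤ : ∀ {t z} N → 0ℚ ≤ t → 0ℚ ≤ z →
    expPartial t (suc N) + z * expPartial t N ≤ expPartial (t + z) (suc N)
  expPartial-suc+*expPartial≤ {t} {z} zero    0≤t 0≤z = begin
    1ℚ + expTerm t 1 + z * 1ℚ           ≡⟨ ℚP.+-assoc 1ℚ (expTerm t 1) (z * 1ℚ) ⟩
    1ℚ + (expTerm t 1 + z * 1ℚ)         ≤⟨ ℚP.+-monoʳ-≤ 1ℚ (expTerm-suc+*expTerm≤ 0 0≤t 0≤z) ⟩
    1ℚ + expTerm (t + z) 1              ∎
  expPartial-suc+*expPartial≤ {t} {z} (suc N) 0≤t 0≤z = begin
    (S₁ + E₂) + z * (S₀ + E₁)           ≡⟨ solve 5 (λ S₁ E₂ z S₀ E₁ → (S₁ :+ E₂) :+ z :* (S₀ :+ E₁) := (S₁ :+ z :* S₀) :+ (E₂ :+ z :* E₁)) refl S₁ E₂ z S₀ E₁ ⟩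
    (S₁ + z * S₀) + (E₂ + z * E₁)       ≤⟨ ℚP.+-mono-≤ (expPartial-suc+*expPartial≤ N 0≤t 0≤z) (expTerm-suc+*expTerm≤ (suc N) 0≤t 0≤z) ⟩
    expPartial (t + z) (suc (suc N))    ∎
    where
    S₀ = expPartial t N
    S₁ = expPartial t (suc N)
    E₁ = expTerm t (suc N)
    E₂ = expTerm t (suc (suc N))

  [1+z]^L≤expPartial : ∀ L {z} → 0ℚ ≤ z → (1ℚ + z) ^ L ≤ expPartial (toℚ L * z) L
  [1+z]^L≤expPartial zero    _   = ℚP.≤-refl
  [1+z]^L≤expPartial (suc L) {z} 0≤z = begin
    (1ℚ + z) * (1ℚ + z) ^ L               ≤⟨ *-monoˡ-≤-nonNeg′ (1ℚ + z) 0≤1+z ([1+z]^L≤expPartial L 0≤z) ⟩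
    (1ℚ + z) * S                          ≡⟨ solve 2 (λ z S → (con 1ℚ :+ z) :* S := S :+ z :* S) refl z S ⟩
    S + z * S                             ≤⟨ ℚP.+-monoˡ-≤ (z * S) (expPartial-≤-suc L 0≤Lz) ⟩
    expPartial (toℚ L * z) (suc L) + z * S ≤⟨ expPartial-suc+*expPartial≤ L 0≤Lz 0≤z ⟩
    expPartial (toℚ L * z + z) (suc L)    ≡⟨ cong (λ t → expPartial t (suc L)) Lz+z≡[1+L]z ⟩
    expPartial (toℚ (suc L) * z) (suc L)  ∎
    where
    S = expPartial (toℚ L * z) L
    0≤1+z : 0ℚ ≤ 1ℚ + z
    0≤1+z = ℚP.+-mono-≤ (toℚ-nonNeg 1) 0≤z
    0≤Lz : 0ℚ ≤ toℚ L * z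
    0≤Lz = *-nonNeg (toℚ-nonNeg L) 0≤z
    Lz+z≡[1+L]z : toℚ L * z + z ≡ toℚ (suc L) * z
    Lz+z≡[1+L]z = trans (solve 2 (λ l z → l :* z :+ z := (con 1ℚ :+ l) :* z) refl (toℚ L) z)
                        (cong (_* z) (sym (toℚ-+ 1 L)))

  -- The constants: S_N(r/4) ≤ (8/7)^2r bounds e^(r/4) from above, (21/20)^20r ≤ S_20r(r) bounds e^r
  -- from below, and 2 ≤ (7/8)^2 (21/20)^20 is the numerical form of 2 e^(1/4) ≤ e.
  2^r*[1-r/m]^m*expPartial≤1 : ∀ r m N → r ℕ.≤ suc m →
    toℚ (2 ℕ.^ r) * ((1ℚ - + r / suc m) ^ suc m * expPartial (+ r / 4) N) ≤ 1ℚ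
  2^r*[1-r/m]^m*expPartial≤1 r m N r≤m = begin
    toℚ (2 ℕ.^ r) * (P * E)    ≤⟨ *-monoʳ-≤-nonNeg′ (P * E) (*-nonNeg 0≤P (expPartial-nonNeg N (/-nonNeg r 3))) 2^r≤αβ ⟩
    α * β * (P * E)            ≡⟨ solve 4 (λ α β P E → α :* β :* (P :* E) := (α :* E) :* (β :* P)) refl α β P E ⟩
    (α * E) * (β * P)          ≤⟨ *-monoʳ-≤-nonNeg′ (β * P) (*-nonNeg (^-nonNeg (20 ℕ.* r) (/-nonNeg 21 19)) 0≤P) αE≤1 ⟩
    1ℚ * (β * P)               ≡⟨ ℚP.*-identityˡ (β * P) ⟩
    β * P                      ≤⟨ *-monoʳ-≤-nonNeg′ P 0≤P β≤F ⟩
    F * P                      ≡⟨ ℚP.*-comm F P ⟩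
    P * F                      ≤⟨ PF≤1 ⟩
    1ℚ                         ∎
    where
    y = + r / suc m
    P = (1ℚ - y) ^ suc m
    E = expPartial (+ r / 4) N
    F = expPartial (toℚ r) (20 ℕ.* r)
    α = (+ 7 / 8) ^ (2 ℕ.* r)
    β = (+ 21 / 20) ^ (20 ℕ.* r)

    0≤P : 0ℚ ≤ P
    0≤P = ^-nonNeg (suc m) (p≤q⇒0≤q-p (/≤1 r≤m))

    toℚ[c*r]*1/d : ∀ c d {q} → toℚ c * (+ 1 / suc d) ≡ q → toℚ (c ℕ.* r) * (+ 1 / suc d) ≡ toℚ r * q
    toℚ[c*r]*1/d c d eq = trans (cong (_* (+ 1 / suc d)) (toℚ-* c r))
      (trans (solve 3 (λ c r i → c :* r :* i := r :* (c :* i)) refl (toℚ c) (toℚ r) (+ 1 / suc d)) (cong (toℚ r *_) eq))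

    αE≤1 : α * E ≤ 1ℚ
    αE≤1 = subst (λ t → α * expPartial t N ≤ 1ℚ) 2r/8≡r/4
      ([1-y]^s*expPartial≤1 (2 ℕ.* r) (+ 1 / 8) N (/-nonNeg 1 7) (/≤1 {1} {7} (ℕ.s≤s ℕ.z≤n)))
      where
      2r/8≡r/4 : toℚ (2 ℕ.* r) * (+ 1 / 8) ≡ + r / 4
      2r/8≡r/4 = trans (toℚ[c*r]*1/d 2 7 refl) (sym (/≡toℚ*1/ r 3))

    PF≤1 : P * F ≤ 1ℚ
    PF≤1 = subst (λ t → P * expPartial t (20 ℕ.* r) ≤ 1ℚ) (toℚ*/≡toℚ r m)
      ([1-y]^s*expPartial≤1 (suc m) y (20 ℕ.* r) (/-nonNeg r m) (/≤1 r≤m))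

    β≤F : β ≤ F
    β≤F = subst (λ t → β ≤ expPartial t (20 ℕ.* r)) 20r/20≡r ([1+z]^L≤expPartial (20 ℕ.* r) (/-nonNeg 1 19))
      where
      20r/20≡r : toℚ (20 ℕ.* r) * (+ 1 / 20) ≡ toℚ r
      20r/20≡r = trans (toℚ[c*r]*1/d 20 19 (toℚ*/≡toℚ 1 19)) (ℚP.*-identityʳ (toℚ r))

    2^r≤αβ : toℚ (2 ℕ.^ r) ≤ α * β
    2^r≤αβ = begin
      toℚ (2 ℕ.^ r)                                  ≡⟨ toℚ-^ 2 r ⟩
      toℚ 2 ^ r                                      ≤⟨ ^-monoˡ-≤ r (toℚ-nonNeg 2) (from-yes (toℚ 2 ℚP.≤? (+ 7 / 8) ^ 2 * (+ 21 / 20) ^ 20)) ⟩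
      ((+ 7 / 8) ^ 2 * (+ 21 / 20) ^ 20) ^ r         ≡⟨ ^-distrib-* ((+ 7 / 8) ^ 2) _ r ⟩
      ((+ 7 / 8) ^ 2) ^ r * ((+ 21 / 20) ^ 20) ^ r   ≡⟨ cong₂ _*_ (^-assocʳ (+ 7 / 8) 2 r) (^-assocʳ (+ 21 / 20) 20 r) ⟩
      α * β                                          ∎

module LeExpBoundIntro where

  open Rationals
  open ExponentialSeries using (expPartial-nonNeg; 2^r*[1-r/m]^m*expPartial≤1)
  open import Data.Nat as ℕ using (ℕ; suc)
  import Data.Nat.Properties as ℕP
  open import Data.Integer using (+_)
  open import Data.Rational as ℚ using (0ℚ; 1ℚ; _/_; _+_; _*_; _-_; _≤_; _<_)
  import Data.Rational.Properties as ℚP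
  open import Data.Rational.Solver using (module +-*-Solver)
  open +-*-Solver using (solve; _:*_; _:-_; con; _:=_)
  open import Relation.Binary.PropositionalEquality using (_≡_; refl; trans; cong; cong₂; subst)
  open ℚP.≤-Reasoning

  LeExpBound-≤ : ∀ {a b c t} → 0ℚ ≤ t → 0ℚ ≤ c → a ≤ b → LeExpBound a b c t
  LeExpBound-≤ {a} {b} {c} {t} 0≤t 0≤c a≤b N = begin
    (a - b) * expPartial t N   ≤⟨ *-monoʳ-≤-nonNeg′ _ (expPartial-nonNeg N 0≤t) (p≤q⇒p-q≤0 a≤b) ⟩
    0ℚ * expPartial t N        ≡⟨ ℚP.*-zeroˡ (expPartial t N) ⟩
    0ℚ                         ≤⟨ 0≤c ⟩
    c                          ∎

  toℚ≤frac : ∀ {a A m} → a ℕ.* suc m ℕ.≤ A → toℚ a ≤ frac A (suc m)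
  toℚ≤frac {a} {A} {m} am≤A = begin
    toℚ a                                   ≡⟨ ℚP.*-identityʳ (toℚ a) ⟨
    toℚ a * 1ℚ                              ≡⟨ cong (toℚ a *_) (toℚ*1/toℚ m) ⟨
    toℚ a * (toℚ (suc m) * (+ 1 / suc m))   ≡⟨ ℚP.*-assoc (toℚ a) _ _ ⟨
    toℚ a * toℚ (suc m) * (+ 1 / suc m)     ≡⟨ cong (_* (+ 1 / suc m)) (toℚ-* a (suc m)) ⟨
    toℚ (a ℕ.* suc m) * (+ 1 / suc m)       ≤⟨ *-monoʳ-≤-nonNeg′ _ (/-nonNeg 1 m) (toℚ-mono-≤ am≤A) ⟩
    toℚ A * (+ 1 / suc m)                   ≡⟨ /≡toℚ*1/ A m ⟨
    frac A (suc m)                          ∎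

  toℚ[m∸r]^m : ∀ r m → r ℕ.≤ suc m →
    toℚ ((suc m ℕ.∸ r) ℕ.^ suc m) ≡ (1ℚ - + r / suc m) ^ suc m * toℚ (suc m ℕ.^ suc m)
  toℚ[m∸r]^m r m r≤m = begin-equality
    toℚ ((suc m ℕ.∸ r) ℕ.^ suc m)                  ≡⟨ toℚ-^ (suc m ℕ.∸ r) (suc m) ⟩
    toℚ (suc m ℕ.∸ r) ^ suc m                      ≡⟨ cong (_^ suc m) m∸r≡[1-r/m]m ⟩
    ((1ℚ - + r / suc m) * toℚ (suc m)) ^ suc m     ≡⟨ ^-distrib-* (1ℚ - + r / suc m) (toℚ (suc m)) (suc m) ⟩
    (1ℚ - + r / suc m) ^ suc m * toℚ (suc m) ^ suc m ≡⟨ cong ((1ℚ - + r / suc m) ^ suc m *_) (toℚ-^ (suc m) (suc m)) ⟨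
    (1ℚ - + r / suc m) ^ suc m * toℚ (suc m ℕ.^ suc m) ∎
    where
    m∸r≡[1-r/m]m : toℚ (suc m ℕ.∸ r) ≡ (1ℚ - + r / suc m) * toℚ (suc m)
    m∸r≡[1-r/m]m = begin-equality
      toℚ (suc m ℕ.∸ r)                          ≡⟨ toℚ-∸ r≤m ⟩
      toℚ (suc m) - toℚ r                        ≡⟨ cong (toℚ (suc m) -_) (toℚ*/≡toℚ r m) ⟨
      toℚ (suc m) - toℚ (suc m) * (+ r / suc m)  ≡⟨ solve 2 (λ x y → x :- x :* y := (con 1ℚ :- y) :* x) refl (toℚ (suc m)) (+ r / suc m) ⟩
      (1ℚ - + r / suc m) * toℚ (suc m)           ∎

  -- s ≤ A/m + c · 2^r (1 - r/m)^m with the denominators m^m and m cleared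
  LeExpBound-fromℕ : ∀ {s A c r m} → r ℕ.≤ suc m →
    suc m ℕ.^ suc m ℕ.* suc m ℕ.* s ℕ.≤
      suc m ℕ.^ suc m ℕ.* A ℕ.+ suc m ℕ.* c ℕ.* (2 ℕ.^ r ℕ.* (suc m ℕ.∸ r) ℕ.^ suc m) →
    LeExpBound (toℚ s) (frac A (suc m)) (toℚ c) (+ r / 4)
  LeExpBound-fromℕ {s} {A} {c} {r} {m} r≤m bound N = *-cancelˡ-≤-pos′ q 0<q (begin
    q * ((toℚ s - frac A (suc m)) * E)                      ≡⟨ q*[s-A/m]≡ ⟩
    (toℚ (M ℕ.* suc m ℕ.* s) - toℚ (M ℕ.* A)) * E            ≤⟨ *-monoʳ-≤-nonNeg′ E 0≤E (toℚ-≤-+⇒-≤ {z = suc m ℕ.* c ℕ.* X} bound) ⟩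
    toℚ (suc m ℕ.* c ℕ.* X) * E                             ≡⟨ cong (_* E) toℚX ⟩
    toℚ (suc m) * toℚ c * (T * (P * toℚ M)) * E             ≡⟨ solve 6 (λ m c T P M E → m :* c :* (T :* (P :* M)) :* E := M :* m :* c :* (T :* (P :* E))) refl (toℚ (suc m)) (toℚ c) T P (toℚ M) E ⟩
    q * toℚ c * (T * (P * E))                               ≤⟨ *-monoˡ-≤-nonNeg′ (q * toℚ c) (*-nonNeg (ℚP.<⇒≤ 0<q) (toℚ-nonNeg c)) (2^r*[1-r/m]^m*expPartial≤1 r m N r≤m) ⟩
    q * toℚ c * 1ℚ                                          ≡⟨ ℚP.*-identityʳ (q * toℚ c) ⟩
    q * toℚ c                                               ∎)
    where
    M = suc m ℕ.^ suc m
    X = 2 ℕ.^ r ℕ.* (suc m ℕ.∸ r) ℕ.^ suc m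
    q = toℚ M * toℚ (suc m)
    T = toℚ (2 ℕ.^ r)
    P = (1ℚ - + r / suc m) ^ suc m
    E = expPartial (+ r / 4) N

    0<q : 0ℚ < q
    0<q = subst (0ℚ <_) (toℚ-* M (suc m)) (toℚ-pos (ℕP.*-mono-≤ (ℕP.m^n>0 (suc m) (suc m)) (ℕ.s≤s ℕ.z≤n)))

    0≤E : 0ℚ ≤ E
    0≤E = expPartial-nonNeg N (/-nonNeg r 3)

    toℚX : toℚ (suc m ℕ.* c ℕ.* X) ≡ toℚ (suc m) * toℚ c * (T * (P * toℚ M))
    toℚX = begin-equality
      toℚ (suc m ℕ.* c ℕ.* X)                              ≡⟨ trans (toℚ-* (suc m ℕ.* c) X) (cong₂ _*_ (toℚ-* (suc m) c) (toℚ-* (2 ℕ.^ r) _)) ⟩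
      toℚ (suc m) * toℚ c * (T * toℚ ((suc m ℕ.∸ r) ℕ.^ suc m)) ≡⟨ cong (λ x → toℚ (suc m) * toℚ c * (T * x)) (toℚ[m∸r]^m r m r≤m) ⟩
      toℚ (suc m) * toℚ c * (T * (P * toℚ M))              ∎

    q*[s-A/m]≡ : q * ((toℚ s - frac A (suc m)) * E) ≡ (toℚ (M ℕ.* suc m ℕ.* s) - toℚ (M ℕ.* A)) * E
    q*[s-A/m]≡ = begin-equality
      q * ((toℚ s - frac A (suc m)) * E)
        ≡⟨ solve 5 (λ M m s F E → M :* m :* ((s :- F) :* E) := (M :* m :* s :- M :* (m :* F)) :* E) refl (toℚ M) (toℚ (suc m)) (toℚ s) (frac A (suc m)) E ⟩
      (toℚ M * toℚ (suc m) * toℚ s - toℚ M * (toℚ (suc m) * frac A (suc m))) * E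
        ≡⟨ cong (λ x → (toℚ M * toℚ (suc m) * toℚ s - toℚ M * x) * E) (toℚ*/≡toℚ A m) ⟩
      (toℚ M * toℚ (suc m) * toℚ s - toℚ M * toℚ A) * E
        ≡⟨ cong₂ (λ x y → (x - y) * E) (trans (toℚ-* (M ℕ.* suc m) s) (cong (_* toℚ s) (toℚ-* M (suc m)))) (toℚ-* M A) ⟨
      (toℚ (M ℕ.* suc m ℕ.* s) - toℚ (M ℕ.* A)) * E ∎




module ListLemmas {A : Set} where

  open import Data.Nat using (suc; _+_; _*_; _≤_; z≤n; s≤s)
  open import Data.Nat.Properties using (+-suc; ≤-reflexive)
  open import Data.List using (List; []; _∷_; _++_; [_]; _ʳ++_; length; concatMap; filter)
  open import Data.List.Properties using (length-++; filter-all)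
  open import Data.List.Membership.Propositional using (_∈_)
  open import Data.List.Membership.Propositional.Properties using (∈-++⁺ʳ)
  open import Data.List.Relation.Unary.Any using (here; there)
  open import Data.List.Relation.Unary.All as All using (All; []; _∷_)
  import Data.List.Relation.Unary.All.Properties as All
  open import Data.List.Relation.Unary.AllPairs using ([]; _∷_)
  open import Data.List.Relation.Unary.Linked using (Linked; []; [-]; _∷_)
  open import Data.List.Relation.Unary.Unique.Propositional using (Unique)
  open import Relation.Binary.PropositionalEquality using (_≡_; _≢_; refl; sym; trans; cong; cong₂)
  open import Relation.Binary.Definitions using (DecidableEquality)
  open import Relation.Nullary using (¬_; yes; no; ¬?)

  Unique-++-∷⇒Unique-∷ : ∀ xs {z : A} {ys} → Unique (xs ++ z ∷ ys) → Unique (z ∷ xs)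
  Unique-++-∷⇒Unique-∷ []       _            = [] ∷ []
  Unique-++-∷⇒Unique-∷ (x ∷ xs) {z} (x∉ ∷ uniq) with Unique-++-∷⇒Unique-∷ xs uniq
  ... | z∉xs ∷ uxs = (z≢x ∷ z∉xs) ∷ (All.++⁻ˡ xs x∉ ∷ uxs)
    where
    z≢x : z ≢ x
    z≢x z≡x = All.lookup x∉ (∈-++⁺ʳ xs (here refl)) (sym z≡x)

  Linked-++-∷⇒Linked-∷ʳ : ∀ {R : A → A → Set} xs {y : A} {ys} → Linked R (xs ++ y ∷ ys) → Linked R (xs ++ [ y ])
  Linked-++-∷⇒Linked-∷ʳ []           _          = [-]
  Linked-++-∷⇒Linked-∷ʳ (x ∷ [])     (r ∷ _)    = r ∷ [-]
  Linked-++-∷⇒Linked-∷ʳ (x ∷ x′ ∷ xs) (r ∷ rxs) = r ∷ Linked-++-∷⇒Linked-∷ʳ (x′ ∷ xs) rxs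

  length-ʳ++ : ∀ (xs : List A) {ys} → length (xs ʳ++ ys) ≡ length xs + length ys
  length-ʳ++ []       = refl
  length-ʳ++ (x ∷ xs) {ys} = trans (length-ʳ++ xs) (+-suc (length xs) (length ys))

  Unique-ʳ++⇒Unique : ∀ (xs : List A) {ys} → Unique (xs ʳ++ ys) → Unique ys
  Unique-ʳ++⇒Unique []       uniq = uniq
  Unique-ʳ++⇒Unique (x ∷ xs) uniq with Unique-ʳ++⇒Unique xs uniq
  ... | _ ∷ uys = uys

  ∈-∈-¬Unique-ʳ++ : ∀ {xs ys} {z : A} → z ∈ xs → z ∈ ys → ¬ Unique (xs ʳ++ ys)
  ∈-∈-¬Unique-ʳ++ {x ∷ xs} (here refl) z∈ys uniq with Unique-ʳ++⇒Unique xs uniq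
  ... | x∉ys ∷ _ = All.lookup x∉ys z∈ys refl
  ∈-∈-¬Unique-ʳ++ {x ∷ xs} (there z∈xs) z∈ys = ∈-∈-¬Unique-ʳ++ z∈xs (there z∈ys)

  length-concatMap : ∀ {B : Set} {c} (f : B → List A) → (∀ b → length (f b) ≡ c) →
                     ∀ bs → length (concatMap f bs) ≡ length bs * c
  length-concatMap f len []       = refl
  length-concatMap f len (b ∷ bs) = trans (length-++ (f b)) (cong₂ _+_ (len b) (length-concatMap f len bs))

  EndsAt : A → List A → A → Set
  EndsAt x []       z = x ≡ z
  EndsAt x (y ∷ ys) z = EndsAt y ys z

  EndsAt⇒∈ : ∀ {x} ys {z} → EndsAt x ys z → z ∈ x ∷ ys
  EndsAt⇒∈ []       refl = here refl
  EndsAt⇒∈ (y ∷ ys) ends = there (EndsAt⇒∈ ys ends)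

  module _ (_≟_ : DecidableEquality A) where

    length≤suc-length-filter≢ : ∀ p xs → Unique xs → length xs ≤ suc (length (filter (λ y → ¬? (p ≟ y)) xs))
    length≤suc-length-filter≢ p []       _            = z≤n
    length≤suc-length-filter≢ p (y ∷ ys) (y∉ys ∷ uys) with p ≟ y
    ... | yes refl = s≤s (≤-reflexive (cong length (sym (filter-all (λ y → ¬? (p ≟ y)) y∉ys))))
    ... | no _     = s≤s (length≤suc-length-filter≢ p ys uys)

module NonBacktrackingWalks {n : ℕ} (G : Graph n) where

  open import Data.Nat using (ℕ; zero; suc; _+_; _*_; _∸_; _^_; _≤_; _<_; z≤n; s≤s)
  open import Data.Nat.Properties hiding (_≟_)
  open import Data.Fin using (Fin; _≟_)
  open import Data.List using (List; []; _∷_; _++_; [_]; _ʳ++_; length; concatMap; filter; take)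
  open import Data.List.Properties using (length-++; length-take)
  open import Data.List.Membership.Propositional using (_∈_; find)
  open import Data.List.Membership.Propositional.Properties using (∈-∃++; ∈-concatMap⁻)
  open import Data.List.Relation.Unary.Any using (here; there)
  open import Data.List.Relation.Unary.All as All using (All; []; _∷_)
  import Data.List.Relation.Unary.All.Properties as All
  open import Data.List.Relation.Unary.AllPairs using ([]; _∷_)
  open import Data.List.Relation.Unary.Linked as Linked using (Linked; []; [-]; _∷_)
  open import Data.List.Relation.Unary.Unique.Propositional using (Unique)
  import Data.List.Relation.Unary.Unique.Propositional.Properties as Unique
  open import Data.List.Membership.DecPropositional (_≟_ {n}) using (_∈?_)
  open import Data.Product using (∃-syntax; _×_; _,_; proj₁; proj₂)
  open import Data.Sum using (_⊎_; inj₁; inj₂)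
  open import Data.Empty using (⊥; ⊥-elim)
  open import Data.Unit using (⊤; tt)
  open import Relation.Binary.PropositionalEquality using (_≡_; _≢_; refl; sym; trans; cong; cong₂; subst)
  open import Relation.Nullary using (¬_; yes; no; ¬?)
  import Relation.Unary
  open import Data.Nat.Solver using (module +-*-Solver)
  open +-*-Solver using (solve; _:+_; con; _:=_)
  open ≤-Reasoning
  open ListLemmas

  data NonBacktracking : List (Fin n) → Set where
    []    : NonBacktracking []
    [-]   : ∀ {x} → NonBacktracking [ x ]
    [-,-] : ∀ {x y} → NonBacktracking (x ∷ y ∷ [])
    _∷_   : ∀ {x y z zs} → x ≢ z → NonBacktracking (y ∷ z ∷ zs) → NonBacktracking (x ∷ y ∷ z ∷ zs)

  NBWalk : List (Fin n) → Set
  NBWalk xs = Linked (Adj G) xs × NonBacktracking xs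

  NonBacktracking-tail : ∀ {x xs} → NonBacktracking (x ∷ xs) → NonBacktracking xs
  NonBacktracking-tail [-]      = []
  NonBacktracking-tail [-,-]    = [-]
  NonBacktracking-tail (_ ∷ nb) = nb

  NBWalk-tail : ∀ {x xs} → NBWalk (x ∷ xs) → NBWalk xs
  NBWalk-tail (linked , nb) = Linked.tail linked , NonBacktracking-tail nb

  StartsAway : Fin n → List (Fin n) → Set
  StartsAway p []      = ⊤
  StartsAway p (c ∷ _) = p ≢ c

  NonBacktracking⇒StartsAway : ∀ {x y ys} → NonBacktracking (x ∷ y ∷ ys) → StartsAway x ys
  NonBacktracking⇒StartsAway [-,-]      = tt
  NonBacktracking⇒StartsAway (x≢z ∷ _) = x≢z

  NBWalk-∷ : ∀ {x c rest} → Adj G x c → StartsAway x rest → NBWalk (c ∷ rest) → NBWalk (x ∷ c ∷ rest)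
  NBWalk-∷ {rest = []}    x~c _    (linked , nb) = x~c ∷ linked , [-,-]
  NBWalk-∷ {rest = _ ∷ _} x~c x≢c′ (linked , nb) = x~c ∷ linked , x≢c′ ∷ nb

  NBWalk-ʳ++ : ∀ {y ys a acc} → StartsAway a ys → NBWalk (y ∷ ys) → NBWalk (y ∷ a ∷ acc) →
               NBWalk (ys ʳ++ y ∷ a ∷ acc)
  NBWalk-ʳ++ {ys = []}     _    _                    walk = walk
  NBWalk-ʳ++ {ys = y′ ∷ ys} a≢y′ (y~y′ ∷ linked , nb) walk =
    NBWalk-ʳ++ (NonBacktracking⇒StartsAway nb) (linked , NonBacktracking-tail nb)
               (NBWalk-∷ (Graph.sym G y~y′) (λ y′≡a → a≢y′ (sym y′≡a)) walk)

  NBWalk-repeat⇒cycle : ∀ z pre {post} → NBWalk (z ∷ pre ++ z ∷ post) → Unique (pre ++ z ∷ post) →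
                        HasCycle G (suc (length pre))
  NBWalk-repeat⇒cycle z pre (linked , nb) uniq =
    z , pre , refl , 3≤ pre linked nb , Unique-++-∷⇒Unique-∷ pre uniq , Linked-++-∷⇒Linked-∷ʳ (z ∷ pre) linked
    where
    3≤ : ∀ pre {post} → Linked (Adj G) (z ∷ pre ++ z ∷ post) → NonBacktracking (z ∷ pre ++ z ∷ post) →
         3 ≤ suc (length pre)
    3≤ []          (z~z ∷ _) _         = ⊥-elim (irrefl G z~z)
    3≤ (_ ∷ [])    _         (z≢z ∷ _) = ⊥-elim (z≢z refl)
    3≤ (_ ∷ _ ∷ _) _         _         = s≤s (s≤s (s≤s z≤n))

  NBWalk⇒Unique⊎cycle : ∀ zs → NBWalk zs → Unique zs ⊎ ∃[ m ] m < length zs × HasCycle G m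
  NBWalk⇒Unique⊎cycle []       _    = inj₁ []
  NBWalk⇒Unique⊎cycle (z ∷ zs) walk with NBWalk⇒Unique⊎cycle zs (NBWalk-tail walk)
  ... | inj₂ (m , m<∣zs∣ , cycle) = inj₂ (m , m≤n⇒m≤1+n m<∣zs∣ , cycle)
  ... | inj₁ uniq with z ∈? zs
  ...   | no z∉zs = inj₁ (All.¬Any⇒All¬ zs z∉zs ∷ uniq)
  ...   | yes z∈zs with ∈-∃++ z∈zs
  ...     | pre , post , refl = inj₂ (suc (length pre) , s≤s ∣pre∣<∣zs∣ , NBWalk-repeat⇒cycle z pre walk uniq)
    where
    ∣pre∣<∣zs∣ : length pre < length (pre ++ z ∷ post)
    ∣pre∣<∣zs∣ = subst (length pre <_) (sym (length-++ pre)) (m<m+n (length pre) (s≤s z≤n))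

  NBWalk⇒Unique : ∀ {g zs} → GirthGe G g → NBWalk zs → length zs ≤ g → Unique zs
  NBWalk⇒Unique {zs = zs} girth walk ∣zs∣≤g with NBWalk⇒Unique⊎cycle zs walk
  ... | inj₁ uniq                  = uniq
  ... | inj₂ (m , m<∣zs∣ , cycle) = ⊥-elim (<⇒≱ (<-≤-trans m<∣zs∣ ∣zs∣≤g) (girth m cycle))

  Linked⇒Walk : ∀ {x} ys {z} → Linked (Adj G) (x ∷ ys) → EndsAt x ys z → Walk G x z (length ys)
  Linked⇒Walk []       _            refl = Walk.here
  Linked⇒Walk (y ∷ ys) (x~y ∷ linked) ends = Walk.step x~y (Linked⇒Walk ys linked ends)

  Walk-snoc : ∀ {u w x l} → Walk G u w l → Adj G w x → Walk G u x (suc l)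
  Walk-snoc Walk.here         w~x = Walk.step w~x Walk.here
  Walk-snoc (Walk.step u~v p) w~x = Walk.step u~v (Walk-snoc p w~x)

  Walk-reverse : ∀ {u w l} → Walk G u w l → Walk G w u l
  Walk-reverse Walk.here         = Walk.here
  Walk-reverse (Walk.step u~v p) = Walk-snoc (Walk-reverse p) (Graph.sym G u~v)

  module NonBacktrackingTree {d : ℕ} (minDeg : MinDegGe G d) where

    avoiding : (p : Fin n) → Relation.Unary.Decidable (p ≢_)
    avoiding p y = ¬? (p ≟ y)

    -- In the tree of non-backtracking walks, a vertex x entered from p has as children d - 1 of
    -- its neighbours other than p; the root v is entered from itself.
    children : Fin n → Fin n → List (Fin n)
    children x p = take (d ∸ 1) (filter (avoiding p) (proj₁ (minDeg x)))

    length-children : ∀ x p → length (children x p) ≡ d ∸ 1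
    length-children x p with minDeg x
    ... | nbrs , ∣nbrs∣≡d , uniq , _ = trans (length-take (d ∸ 1) _) (m≤n⇒m⊓n≡m d∸1≤)
      where
      d∸1≤ : d ∸ 1 ≤ length (filter (avoiding p) nbrs)
      d∸1≤ = subst (λ l → l ∸ 1 ≤ _) ∣nbrs∣≡d (∸-monoˡ-≤ 1 (length≤suc-length-filter≢ _≟_ p nbrs uniq))

    Unique-children : ∀ x p → Unique (children x p)
    Unique-children x p = Unique.take⁺ (d ∸ 1) (Unique.filter⁺ (avoiding p) (proj₁ (proj₂ (proj₂ (minDeg x)))))

    children-adjacent : ∀ x p → All (Adj G x) (children x p)
    children-adjacent x p = All.take⁺ (d ∸ 1) (All.filter⁺ (avoiding p) (proj₂ (proj₂ (proj₂ (minDeg x)))))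

    children-avoid : ∀ x p → All (p ≢_) (children x p)
    children-avoid x p = All.take⁺ (d ∸ 1) (All.all-filter (avoiding p) (proj₁ (minDeg x)))

    leaves : Fin n → Fin n → ℕ → List (Fin n)
    leaves x p zero    = [ x ]
    leaves x p (suc j) = concatMap (λ c → leaves c x j) (children x p)

    length-leaves : ∀ x p j → length (leaves x p j) ≡ (d ∸ 1) ^ j
    length-leaves x p zero    = refl
    length-leaves x p (suc j) = trans (length-concatMap (λ c → leaves c x j) (λ c → length-leaves c x j) (children x p))
                                      (cong (_* (d ∸ 1) ^ j) (length-children x p))

    record TreePath (p x : Fin n) (j : ℕ) (z : Fin n) : Set where
      field
        rest    : List (Fin n)
        length≡ : length rest ≡ j
        walk    : NBWalk (x ∷ rest)
        away    : StartsAway p rest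
        ends    : EndsAt x rest z
    open TreePath

    leaf⇒TreePath : ∀ {x p} j {z} → z ∈ leaves x p j → TreePath p x j z
    leaf⇒TreePath zero (here refl) = record { rest = [] ; length≡ = refl ; walk = [-] , [-] ; away = tt ; ends = refl }
    leaf⇒TreePath {x} {p} (suc j) z∈ with find (∈-concatMap⁻ (λ c → leaves c x j) {xs = children x p} z∈)
    ... | c , c∈ , z∈c with leaf⇒TreePath j z∈c
    ... | P = record
      { rest    = c ∷ rest P
      ; length≡ = cong suc (length≡ P)
      ; walk    = NBWalk-∷ (All.lookup (children-adjacent x p) c∈) (away P) (walk P)
      ; away    = All.lookup (children-avoid x p) c∈
      ; ends    = ends P
      }

    module _ {k : ℕ} (girth : GirthGe G (2 * k + 1)) where

      -- Two such walks with a common end close up, through x, into a non-backtracking walk of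
      -- length 2j + 3 ≤ 2k + 1 visiting that end twice.
      TreePaths-disjoint : ∀ {x c c′ j z} → suc j ≤ k → Adj G x c → Adj G x c′ → c ≢ c′ →
                           TreePath x c j z → TreePath x c′ j z → ⊥
      TreePaths-disjoint {x} {c} {c′} {j} j<k x~c x~c′ c≢c′ P Q =
        ∈-∈-¬Unique-ʳ++ (EndsAt⇒∈ (rest P) (ends P)) (there (EndsAt⇒∈ (rest Q) (ends Q)))
          (NBWalk⇒Unique girth cycle-walk ∣cycle-walk∣≤2k+1)
        where
        cycle-walk : NBWalk (rest P ʳ++ c ∷ x ∷ c′ ∷ rest Q)
        cycle-walk = NBWalk-ʳ++ (away P) (walk P)
                       (NBWalk-∷ (Graph.sym G x~c) c≢c′ (NBWalk-∷ x~c′ (away Q) (walk Q)))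
        ∣cycle-walk∣≤2k+1 : length (rest P ʳ++ c ∷ x ∷ c′ ∷ rest Q) ≤ 2 * k + 1
        ∣cycle-walk∣≤2k+1 = begin
          length (rest P ʳ++ c ∷ x ∷ c′ ∷ rest Q)  ≡⟨ length-ʳ++ (rest P) ⟩
          length (rest P) + (3 + length (rest Q))   ≡⟨ cong₂ (λ a b → a + (3 + b)) (length≡ P) (length≡ Q) ⟩
          j + (3 + j)                               ≡⟨ solve 1 (λ j → j :+ (con 3 :+ j) := (con 1 :+ j) :+ ((con 1 :+ j) :+ con 0) :+ con 1) refl j ⟩
          2 * suc j + 1                             ≤⟨ +-monoˡ-≤ 1 (*-monoʳ-≤ 2 j<k) ⟩
          2 * k + 1                                 ∎

      mutual
        Unique-leaves : ∀ x p j → j ≤ k → Unique (leaves x p j)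
        Unique-leaves x p zero    _   = [] ∷ []
        Unique-leaves x p (suc j) j<k = Unique-branches x (children x p) j j<k (Unique-children x p) (children-adjacent x p)

        Unique-branches : ∀ x cs j → suc j ≤ k → Unique cs → All (Adj G x) cs →
                          Unique (concatMap (λ c → leaves c x j) cs)
        Unique-branches x []       j _   _             _            = []
        Unique-branches x (c ∷ cs) j j<k (c∉cs ∷ uniq) (x~c ∷ x~cs) =
          Unique.++⁺ (Unique-leaves c x j (<⇒≤ j<k)) (Unique-branches x cs j j<k uniq x~cs) disjoint
          where
          disjoint : ∀ {z} → ¬ (z ∈ leaves c x j × z ∈ concatMap (λ c → leaves c x j) cs)
          disjoint (z∈c , z∈cs) with find (∈-concatMap⁻ (λ c → leaves c x j) {xs = cs} z∈cs)
          ... | c′ , c′∈cs , z∈c′ = TreePaths-disjoint j<k x~c (All.lookup x~cs c′∈cs) (All.lookup c∉cs c′∈cs)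
                                      (leaf⇒TreePath j z∈c) (leaf⇒TreePath j z∈c′)

      many-within-distance : 1 ≤ k → ∀ v → AtLeast G ((d ∸ 1) ^ k) (InN G k v)
      many-within-distance 1≤k v = leaves v v k , length-leaves v v k , Unique-leaves v v k ≤-refl , All.tabulate inN
        where
        inN : ∀ {z} → z ∈ leaves v v k → InN G k v z
        inN z∈ with leaf⇒TreePath k z∈
        ... | P = z≢v (rest P) (length≡ P) (ends P) (NBWalk⇒Unique girth (walk P) ∣walk∣≤2k+1)
                , k , ≤-refl , Walk-reverse (subst (Walk G v _) (length≡ P) (Linked⇒Walk (rest P) (proj₁ (walk P)) (ends P)))
          where
          ∣walk∣≤2k+1 : suc (length (rest P)) ≤ 2 * k + 1
          ∣walk∣≤2k+1 = subst (λ l → suc l ≤ 2 * k + 1) (sym (length≡ P)) (subst (suc k ≤_) (+-comm 1 (2 * k)) (s≤s (m≤m+n k (k + 0))))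
          z≢v : ∀ rest {z} → length rest ≡ k → EndsAt v rest z → Unique (v ∷ rest) → z ≢ v
          z≢v []       ∣rest∣≡k _    _         = ⊥-elim (<⇒≱ 1≤k (≤-reflexive (sym ∣rest∣≡k)))
          z≢v (e ∷ es) _       ends (v∉ ∷ _) z≡v = All.lookup v∉ (EndsAt⇒∈ es ends) (sym z≡v)


module Subsets where

  open import Data.Nat using (zero; suc; _+_; _≤_; z≤n; s≤s)
  open import Data.Nat.Properties using (≤-reflexive; ≤-trans; +-suc; m≤n+m; +-monoʳ-≤; +-*-semiring)
  open import Algebra.Properties.Semiring.Sum +-*-semiring using (sum-syntax)
  open import Data.Vec using ([]; _∷_)
  open import Data.Vec.Base using () renaming (here to hereᵛ; there to thereᵛ)
  open import Data.Fin using (Fin; zero; suc)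
  open import Data.Fin.Properties using (suc-injective)
  open import Data.Fin.Subset using (Subset; inside; outside; _∈_; _∉_; ∣_∣; ⊥; ⁅_⁆; _∪_)
  open import Data.Fin.Subset.Properties using (∉⊥; ∣⊥∣≡0; x∈⁅x⁆; x∈⁅y⁆⇒x≡y; ∣⁅x⁆∣≡1; x∈p∪q⁺; x∈p∪q⁻; ∪-identityˡ)
  open import Data.List using (List; []; _∷_; length; map)
  open import Data.List.Properties using (length-map)
  import Data.List.Membership.Propositional as List
  open import Data.List.Relation.Unary.Any using (here; there)
  open import Data.List.Relation.Unary.All as All using (All; []; _∷_)
  import Data.List.Relation.Unary.All.Properties as All
  open import Data.List.Relation.Unary.AllPairs using ([]; _∷_)
  open import Data.List.Relation.Unary.Unique.Propositional using (Unique)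
  import Data.List.Relation.Unary.Unique.Propositional.Properties as Unique
  open import Data.Product using (Σ; _×_; _,_)
  open import Data.Sum using (inj₁; inj₂)
  open import Data.Empty using (⊥-elim)
  open import Relation.Binary.PropositionalEquality using (_≡_; _≢_; refl; sym; trans; cong)
  open import Function using (_∘_)

  ∣p∪q∣≤∣p∣+∣q∣ : ∀ {n} (p q : Subset n) → ∣ p ∪ q ∣ ≤ ∣ p ∣ + ∣ q ∣
  ∣p∪q∣≤∣p∣+∣q∣ []           []           = z≤n
  ∣p∪q∣≤∣p∣+∣q∣ (inside  ∷ p) (inside  ∷ q) = s≤s (≤-trans (∣p∪q∣≤∣p∣+∣q∣ p q) (≤-trans (m≤n+m _ 1) (≤-reflexive (sym (+-suc ∣ p ∣ ∣ q ∣)))))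
  ∣p∪q∣≤∣p∣+∣q∣ (inside  ∷ p) (outside ∷ q) = s≤s (∣p∪q∣≤∣p∣+∣q∣ p q)
  ∣p∪q∣≤∣p∣+∣q∣ (outside ∷ p) (inside  ∷ q) = ≤-trans (s≤s (∣p∪q∣≤∣p∣+∣q∣ p q)) (≤-reflexive (sym (+-suc ∣ p ∣ ∣ q ∣)))
  ∣p∪q∣≤∣p∣+∣q∣ (outside ∷ p) (outside ∷ q) = ∣p∪q∣≤∣p∣+∣q∣ p q

  ∣⁅x⁆∪p∣≡1+∣p∣ : ∀ {n} (x : Fin n) (p : Subset n) → x ∉ p → ∣ ⁅ x ⁆ ∪ p ∣ ≡ suc ∣ p ∣
  ∣⁅x⁆∪p∣≡1+∣p∣ zero    (inside  ∷ p) x∉p = ⊥-elim (x∉p hereᵛ)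
  ∣⁅x⁆∪p∣≡1+∣p∣ zero    (outside ∷ p) _   = cong (suc ∘ ∣_∣) (∪-identityˡ p)
  ∣⁅x⁆∪p∣≡1+∣p∣ (suc x) (inside  ∷ p) x∉p = cong suc (∣⁅x⁆∪p∣≡1+∣p∣ x p (x∉p ∘ thereᵛ))
  ∣⁅x⁆∪p∣≡1+∣p∣ (suc x) (outside ∷ p) x∉p = ∣⁅x⁆∪p∣≡1+∣p∣ x p (x∉p ∘ thereᵛ)

  fromList : ∀ {n} → List (Fin n) → Subset n
  fromList []       = ⊥
  fromList (x ∷ xs) = ⁅ x ⁆ ∪ fromList xs

  ∈-fromList⁺ : ∀ {n} {x : Fin n} {xs} → x List.∈ xs → x ∈ fromList xs
  ∈-fromList⁺ {xs = y ∷ _}  (here refl) = x∈p∪q⁺ (inj₁ (x∈⁅x⁆ y))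
  ∈-fromList⁺ {xs = _ ∷ _}  (there x∈)  = x∈p∪q⁺ (inj₂ (∈-fromList⁺ x∈))

  ∈-fromList⁻ : ∀ {n} {x : Fin n} xs → x ∈ fromList xs → x List.∈ xs
  ∈-fromList⁻ []       x∈ = ⊥-elim (∉⊥ x∈)
  ∈-fromList⁻ (y ∷ xs) x∈ with x∈p∪q⁻ ⁅ y ⁆ (fromList xs) x∈
  ... | inj₁ x∈⁅y⁆ = here (x∈⁅y⁆⇒x≡y y x∈⁅y⁆)
  ... | inj₂ x∈xs  = there (∈-fromList⁻ xs x∈xs)

  ∣fromList∣≤length : ∀ {n} (xs : List (Fin n)) → ∣ fromList xs ∣ ≤ length xs
  ∣fromList∣≤length {n} []       = ≤-reflexive (∣⊥∣≡0 n)
  ∣fromList∣≤length (x ∷ xs) = ≤-trans (∣p∪q∣≤∣p∣+∣q∣ ⁅ x ⁆ (fromList xs))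
    (≤-trans (≤-reflexive (cong (_+ ∣ fromList xs ∣) (∣⁅x⁆∣≡1 x))) (s≤s (∣fromList∣≤length xs)))

  ∣fromList∣≡length : ∀ {n} {xs : List (Fin n)} → Unique xs → ∣ fromList xs ∣ ≡ length xs
  ∣fromList∣≡length {n} {[]} _           = ∣⊥∣≡0 n
  ∣fromList∣≡length {xs = x ∷ xs} (x∉ ∷ uniq) =
    trans (∣⁅x⁆∪p∣≡1+∣p∣ x (fromList xs) (λ x∈ → All.lookup x∉ (∈-fromList⁻ xs x∈) refl)) (cong suc (∣fromList∣≡length uniq))

  elements : ∀ {n} (p : Subset n) → Σ (List (Fin n)) λ xs → length xs ≡ ∣ p ∣ × Unique xs × All (_∈ p) xs
  elements []      = [] , refl , [] , []
  elements (s ∷ p) with elements p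
  ... | xs , ∣xs∣≡∣p∣ , uniq , xs⊆p = go s
    where
    suc-xs-unique : Unique (map suc xs)
    suc-xs-unique = Unique.map⁺ suc-injective uniq
    suc-xs⊆ : ∀ {s} → All (_∈ s ∷ p) (map suc xs)
    suc-xs⊆ = All.gmap⁺ thereᵛ xs⊆p
    zero∉ : All (zero ≢_) (map suc xs)
    zero∉ = All.map⁺ (All.tabulate (λ _ ()))
    go : ∀ s → Σ (List _) λ ys → length ys ≡ ∣ s ∷ p ∣ × Unique ys × All (_∈ s ∷ p) ys
    go inside  = zero ∷ map suc xs , cong suc (trans (length-map suc xs) ∣xs∣≡∣p∣) , zero∉ ∷ suc-xs-unique , hereᵛ ∷ suc-xs⊆
    go outside = map suc xs , trans (length-map suc xs) ∣xs∣≡∣p∣ , suc-xs-unique , suc-xs⊆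

  ⋃ᶠ : ∀ {n m} → (Fin m → Subset n) → Subset n
  ⋃ᶠ {m = zero}  F = ⊥
  ⋃ᶠ {m = suc m} F = F zero ∪ ⋃ᶠ (λ i → F (suc i))

  ∈-⋃ᶠ⁺ : ∀ {n m} (F : Fin m → Subset n) i {x} → x ∈ F i → x ∈ ⋃ᶠ F
  ∈-⋃ᶠ⁺ F zero    x∈ = x∈p∪q⁺ (inj₁ x∈)
  ∈-⋃ᶠ⁺ F (suc i) x∈ = x∈p∪q⁺ (inj₂ (∈-⋃ᶠ⁺ (λ j → F (suc j)) i x∈))

  ∣⋃ᶠ∣≤∑ : ∀ {n m} (F : Fin m → Subset n) → ∣ ⋃ᶠ F ∣ ≤ ∑[ i < m ] ∣ F i ∣
  ∣⋃ᶠ∣≤∑ {n} {zero}  F = ≤-reflexive (∣⊥∣≡0 n)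
  ∣⋃ᶠ∣≤∑ {n} {suc m} F = ≤-trans (∣p∪q∣≤∣p∣+∣q∣ (F zero) _) (+-monoʳ-≤ ∣ F zero ∣ (∣⋃ᶠ∣≤∑ (λ i → F (suc i))))

module SubsetSums where

  open import Data.Nat using (zero; suc; _+_; _*_; _^_; _≤_; _<_; _<?_; _≤?_; z≤n; >-nonZero)
  open import Data.Nat.Properties
  open import Data.Nat.Solver using (module +-*-Solver)
  open +-*-Solver using (solve; _:+_; _:*_; con; _:=_)
  open import Data.Vec using ([]; _∷_)
  open import Data.Fin using (Fin; zero; suc)
  open import Data.Fin.Subset using (Subset; inside; outside; ∣_∣; _∩_; ∁)
  open import Algebra.Properties.Semiring.Sum +-*-semiring using (sum-syntax; ∑-distrib-+)
  open import Data.Product using (∃; _,_)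
  open import Relation.Binary.PropositionalEquality using (_≡_; refl; sym; trans; cong; cong₂)
  open import Relation.Nullary using (yes; no)
  open import Algebra.Properties.CommutativeSemigroup *-commutativeSemigroup using (x∙yz≈y∙xz)
  open ≤-Reasoning

  ∑ˢ : (n : ℕ) → (Subset n → ℕ) → ℕ
  ∑ˢ zero    f = f []
  ∑ˢ (suc n) f = ∑ˢ n (λ T → f (inside ∷ T)) + ∑ˢ n (λ T → f (outside ∷ T))

  infix 6.5 ∑ˢ
  syntax ∑ˢ n (λ T → x) = ∑[ T ⊆ n ] x

  ∑ˢ-cong : ∀ n {f g : Subset n → ℕ} → (∀ T → f T ≡ g T) → ∑ˢ n f ≡ ∑ˢ n g
  ∑ˢ-cong zero    f≡g = f≡g []
  ∑ˢ-cong (suc n) f≡g = cong₂ _+_ (∑ˢ-cong n (λ T → f≡g (inside ∷ T))) (∑ˢ-cong n (λ T → f≡g (outside ∷ T)))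

  ∑ˢ-mono-≤ : ∀ n {f g : Subset n → ℕ} → (∀ T → f T ≤ g T) → ∑ˢ n f ≤ ∑ˢ n g
  ∑ˢ-mono-≤ zero    f≤g = f≤g []
  ∑ˢ-mono-≤ (suc n) f≤g = +-mono-≤ (∑ˢ-mono-≤ n (λ T → f≤g (inside ∷ T))) (∑ˢ-mono-≤ n (λ T → f≤g (outside ∷ T)))

  ∑ˢ-distrib-+ : ∀ n (f g : Subset n → ℕ) → ∑[ T ⊆ n ] (f T + g T) ≡ ∑ˢ n f + ∑ˢ n g
  ∑ˢ-distrib-+ zero    f g = refl
  ∑ˢ-distrib-+ (suc n) f g = begin-equality
    ∑ˢ n (λ T → f (inside ∷ T) + g (inside ∷ T)) + ∑ˢ n (λ T → f (outside ∷ T) + g (outside ∷ T))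
      ≡⟨ cong₂ _+_ (∑ˢ-distrib-+ n _ _) (∑ˢ-distrib-+ n _ _) ⟩
    (f₁ + g₁) + (f₀ + g₀)
      ≡⟨ solve 4 (λ a b c d → (a :+ b) :+ (c :+ d) := (a :+ c) :+ (b :+ d)) refl f₁ g₁ f₀ g₀ ⟩
    (f₁ + f₀) + (g₁ + g₀) ∎
    where
    f₁ = ∑ˢ n (λ T → f (inside ∷ T))
    f₀ = ∑ˢ n (λ T → f (outside ∷ T))
    g₁ = ∑ˢ n (λ T → g (inside ∷ T))
    g₀ = ∑ˢ n (λ T → g (outside ∷ T))

  ∑ˢ-*ˡ : ∀ n c (f : Subset n → ℕ) → ∑[ T ⊆ n ] c * f T ≡ c * ∑ˢ n f
  ∑ˢ-*ˡ zero    c f = refl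
  ∑ˢ-*ˡ (suc n) c f = trans (cong₂ _+_ (∑ˢ-*ˡ n c _) (∑ˢ-*ˡ n c _)) (sym (*-distribˡ-+ c _ _))

  ∑-mono-≤ : ∀ {m} {f g : Fin m → ℕ} → (∀ i → f i ≤ g i) → ∑[ i < m ] f i ≤ ∑[ i < m ] g i
  ∑-mono-≤ {zero}  f≤g = z≤n
  ∑-mono-≤ {suc m} f≤g = +-mono-≤ (f≤g zero) (∑-mono-≤ (λ i → f≤g (suc i)))

  ∑-const : ∀ m c → ∑[ i < m ] c ≡ m * c
  ∑-const zero    c = refl
  ∑-const (suc m) c = cong (c +_) (∑-const m c)

  ∑ˢ-comm-∑ : ∀ n m (h : Fin m → Subset n → ℕ) → ∑[ T ⊆ n ] ∑[ v < m ] h v T ≡ ∑[ v < m ] ∑ˢ n (h v)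
  ∑ˢ-comm-∑ zero    m h = refl
  ∑ˢ-comm-∑ (suc n) m h =
    trans (cong₂ _+_ (∑ˢ-comm-∑ n m _) (∑ˢ-comm-∑ n m _))
          (sym (∑-distrib-+ (λ v → ∑ˢ n (λ T → h v (inside ∷ T))) (λ v → ∑ˢ n (λ T → h v (outside ∷ T)))))

  weighted-average : ∀ n (w h : Subset n → ℕ) B → (∀ T → 0 < w T) →
                     ∑[ T ⊆ n ] w T * h T ≤ ∑ˢ n w * B → ∃ λ T → h T ≤ B
  weighted-average zero    w h B w>0 wh≤wB = [] , *-cancelˡ-≤ (w []) {{>-nonZero (w>0 [])}} wh≤wB
  weighted-average (suc n) w h B w>0 wh≤wB
    with ∑ˢ n (λ T → w (inside ∷ T) * h (inside ∷ T)) ≤? ∑ˢ n (λ T → w (inside ∷ T)) * B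
  ... | yes inside-ok with weighted-average n (λ T → w (inside ∷ T)) (λ T → h (inside ∷ T)) B (λ T → w>0 (inside ∷ T)) inside-ok
  ...   | T , hT≤B = inside ∷ T , hT≤B
  weighted-average (suc n) w h B w>0 wh≤wB | no inside-bad
    with weighted-average n (λ T → w (outside ∷ T)) (λ T → h (outside ∷ T)) B (λ T → w>0 (outside ∷ T)) outside-ok
    where
    outside-ok : ∑ˢ n (λ T → w (outside ∷ T) * h (outside ∷ T)) ≤ ∑ˢ n (λ T → w (outside ∷ T)) * B
    outside-ok = +-cancelˡ-≤ (∑ˢ n (λ T → w (inside ∷ T)) * B) _ _ (begin
      ∑ˢ n (λ T → w (inside ∷ T)) * B + ∑ˢ n (λ T → w (outside ∷ T) * h (outside ∷ T))
        ≤⟨ +-monoˡ-≤ _ (<⇒≤ (≰⇒> inside-bad)) ⟩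
      ∑ˢ n (λ T → w (inside ∷ T) * h (inside ∷ T)) + ∑ˢ n (λ T → w (outside ∷ T) * h (outside ∷ T))
        ≤⟨ wh≤wB ⟩
      (∑ˢ n (λ T → w (inside ∷ T)) + ∑ˢ n (λ T → w (outside ∷ T))) * B
        ≡⟨ *-distribʳ-+ B (∑ˢ n (λ T → w (inside ∷ T))) _ ⟩
      ∑ˢ n (λ T → w (inside ∷ T)) * B + ∑ˢ n (λ T → w (outside ∷ T)) * B ∎)
  ... | T , hT≤B = outside ∷ T , hT≤B

  hit : ∀ {n} → Subset n → Subset n → ℕ
  hit T U = ∣ T ∩ U ∣

  miss : ∀ {n} → Subset n → Subset n → ℕ
  miss T U = ∣ ∁ T ∩ U ∣

  hit+miss≡∣U∣ : ∀ {n} (T U : Subset n) → hit T U + miss T U ≡ ∣ U ∣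
  hit+miss≡∣U∣ []            []            = refl
  hit+miss≡∣U∣ (inside  ∷ T) (inside  ∷ U) = cong suc (hit+miss≡∣U∣ T U)
  hit+miss≡∣U∣ (inside  ∷ T) (outside ∷ U) = hit+miss≡∣U∣ T U
  hit+miss≡∣U∣ (outside ∷ T) (inside  ∷ U) = trans (+-suc (hit T U) (miss T U)) (cong suc (hit+miss≡∣U∣ T U))
  hit+miss≡∣U∣ (outside ∷ T) (outside ∷ U) = hit+miss≡∣U∣ T U

  𝟙[_<_] : ℕ → ℕ → ℕ
  𝟙[ h < r ] with h <? r
  ... | yes _ = 1
  ... | no  _ = 0

  2^∣U∣*𝟙[hit<r]≤2^r*2^miss : ∀ {n} (T U : Subset n) r → 2 ^ ∣ U ∣ * 𝟙[ hit T U < r ] ≤ 2 ^ r * 2 ^ miss T U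
  2^∣U∣*𝟙[hit<r]≤2^r*2^miss T U r with hit T U <? r
  ... | no  _         = ≤-trans (≤-reflexive (*-zeroʳ (2 ^ ∣ U ∣))) z≤n
  ... | yes hit<r = begin
    2 ^ ∣ U ∣ * 1                   ≡⟨ *-identityʳ _ ⟩
    2 ^ ∣ U ∣                       ≡⟨ cong (2 ^_) (hit+miss≡∣U∣ T U) ⟨
    2 ^ (hit T U + miss T U)        ≡⟨ ^-distribˡ-+-* 2 (hit T U) _ ⟩
    2 ^ hit T U * 2 ^ miss T U      ≤⟨ *-monoˡ-≤ (2 ^ miss T U) (^-monoʳ-≤ 2 (<⇒≤ hit<r)) ⟩
    2 ^ r * 2 ^ miss T U            ∎

  module Weights (a b : ℕ) where

    -- a^|T| b^(n - |T|): up to the factor (a + b)^n, the probability of T when every vertex is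
    -- chosen independently with probability a / (a + b)
    weight : ∀ {n} → Subset n → ℕ
    weight []            = 1
    weight (inside  ∷ T) = a * weight T
    weight (outside ∷ T) = b * weight T

    ∑-weight : ∀ n → ∑[ T ⊆ n ] weight T ≡ (a + b) ^ n
    ∑-weight zero    = refl
    ∑-weight (suc n) = begin-equality
      (∑[ T ⊆ n ] a * weight T) + (∑[ T ⊆ n ] b * weight T)  ≡⟨ cong₂ _+_ (∑ˢ-*ˡ n a weight) (∑ˢ-*ˡ n b weight) ⟩
      a * ∑ˢ n weight + b * ∑ˢ n weight                   ≡⟨ *-distribʳ-+ (∑ˢ n weight) a b ⟨
      (a + b) * ∑ˢ n weight                               ≡⟨ cong ((a + b) *_) (∑-weight n) ⟩
      (a + b) ^ suc n                                     ∎

    ∑-weight*∣T∣ : ∀ n → (a + b) * (∑[ T ⊆ n ] weight T * ∣ T ∣) ≡ n * a * (a + b) ^ n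
    ∑-weight*∣T∣ zero    = *-zeroʳ (a + b)
    ∑-weight*∣T∣ (suc n) = begin-equality
      (a + b) * ((∑[ T ⊆ n ] a * weight T * suc ∣ T ∣) + (∑[ T ⊆ n ] b * weight T * ∣ T ∣))
        ≡⟨ cong (λ x → (a + b) * x) (cong₂ _+_ inside-part outside-part) ⟩
      (a + b) * ((a * ∑ˢ n weight + a * C) + b * C)
        ≡⟨ cong (λ W → (a + b) * ((a * W + a * C) + b * C)) (∑-weight n) ⟩
      (a + b) * ((a * (a + b) ^ n + a * C) + b * C)
        ≡⟨ solve 4 (λ a b p C → (a :+ b) :* ((a :* p :+ a :* C) :+ b :* C) := a :* ((a :+ b) :* p) :+ (a :+ b) :* ((a :+ b) :* C)) refl a b ((a + b) ^ n) C ⟩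
      a * (a + b) ^ suc n + (a + b) * ((a + b) * C)
        ≡⟨ cong (λ x → a * (a + b) ^ suc n + (a + b) * x) (∑-weight*∣T∣ n) ⟩
      a * (a + b) ^ suc n + (a + b) * (n * a * (a + b) ^ n)
        ≡⟨ solve 4 (λ a b n p → a :* ((a :+ b) :* p) :+ (a :+ b) :* (n :* a :* p) := (con 1 :+ n) :* a :* ((a :+ b) :* p)) refl a b n ((a + b) ^ n) ⟩
      suc n * a * (a + b) ^ suc n ∎
      where
      C = ∑[ T ⊆ n ] weight T * ∣ T ∣
      inside-part : ∑[ T ⊆ n ] a * weight T * suc ∣ T ∣ ≡ a * ∑ˢ n weight + a * C
      inside-part = begin-equality
        ∑[ T ⊆ n ] a * weight T * suc ∣ T ∣
          ≡⟨ ∑ˢ-cong n (λ T → solve 3 (λ a w t → a :* w :* (con 1 :+ t) := a :* w :+ a :* (w :* t)) refl a (weight T) ∣ T ∣) ⟩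
        ∑[ T ⊆ n ] (a * weight T + a * (weight T * ∣ T ∣))
          ≡⟨ ∑ˢ-distrib-+ n _ _ ⟩
        (∑[ T ⊆ n ] a * weight T) + (∑[ T ⊆ n ] a * (weight T * ∣ T ∣))
          ≡⟨ cong₂ _+_ (∑ˢ-*ˡ n a weight) (∑ˢ-*ˡ n a _) ⟩
        a * ∑ˢ n weight + a * C ∎
      outside-part : ∑[ T ⊆ n ] b * weight T * ∣ T ∣ ≡ b * C
      outside-part = trans (∑ˢ-cong n (λ T → *-assoc b (weight T) ∣ T ∣)) (∑ˢ-*ˡ n b _)

    ∑-weight*c^miss : ∀ {n} c (U : Subset n) →
                      (∑[ T ⊆ n ] weight T * c ^ miss T U) * (a + b) ^ ∣ U ∣ ≡ (a + c * b) ^ ∣ U ∣ * (a + b) ^ n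
    ∑-weight*c^miss c [] = refl
    ∑-weight*c^miss {suc n} c (inside ∷ U) = begin-equality
      ((∑[ T ⊆ n ] a * weight T * c ^ miss T U) + (∑[ T ⊆ n ] b * weight T * (c * c ^ miss T U))) * (a + b) ^ suc ∣ U ∣
        ≡⟨ cong (_* (a + b) ^ suc ∣ U ∣) (cong₂ _+_
             (trans (∑ˢ-cong n (λ T → *-assoc a (weight T) _)) (∑ˢ-*ˡ n a _))
             (trans (∑ˢ-cong n (λ T → solve 4 (λ b w c p → b :* w :* (c :* p) := c :* b :* (w :* p)) refl b (weight T) c (c ^ miss T U))) (∑ˢ-*ˡ n (c * b) _))) ⟩
      (a * M + c * b * M) * ((a + b) * (a + b) ^ ∣ U ∣)
        ≡⟨ solve 5 (λ a cb M s p → (a :* M :+ cb :* M) :* (s :* p) := (a :+ cb) :* s :* (M :* p)) refl a (c * b) M (a + b) ((a + b) ^ ∣ U ∣) ⟩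
      (a + c * b) * (a + b) * (M * (a + b) ^ ∣ U ∣)
        ≡⟨ cong ((a + c * b) * (a + b) *_) (∑-weight*c^miss c U) ⟩
      (a + c * b) * (a + b) * ((a + c * b) ^ ∣ U ∣ * (a + b) ^ n)
        ≡⟨ solve 4 (λ q s Q P → q :* s :* (Q :* P) := q :* Q :* (s :* P)) refl (a + c * b) (a + b) ((a + c * b) ^ ∣ U ∣) ((a + b) ^ n) ⟩
      (a + c * b) ^ suc ∣ U ∣ * (a + b) ^ suc n ∎
      where M = ∑[ T ⊆ n ] weight T * c ^ miss T U
    ∑-weight*c^miss {suc n} c (outside ∷ U) = begin-equality
      ((∑[ T ⊆ n ] a * weight T * c ^ miss T U) + (∑[ T ⊆ n ] b * weight T * c ^ miss T U)) * (a + b) ^ ∣ U ∣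
        ≡⟨ cong (_* (a + b) ^ ∣ U ∣) (cong₂ _+_
             (trans (∑ˢ-cong n (λ T → *-assoc a (weight T) _)) (∑ˢ-*ˡ n a _))
             (trans (∑ˢ-cong n (λ T → *-assoc b (weight T) _)) (∑ˢ-*ˡ n b _))) ⟩
      (a * M + b * M) * (a + b) ^ ∣ U ∣
        ≡⟨ solve 4 (λ a b M p → (a :* M :+ b :* M) :* p := (a :+ b) :* (M :* p)) refl a b M ((a + b) ^ ∣ U ∣) ⟩
      (a + b) * (M * (a + b) ^ ∣ U ∣)
        ≡⟨ cong ((a + b) *_) (∑-weight*c^miss c U) ⟩
      (a + b) * ((a + c * b) ^ ∣ U ∣ * (a + b) ^ n)
        ≡⟨ solve 3 (λ s Q P → s :* (Q :* P) := Q :* (s :* P)) refl (a + b) ((a + c * b) ^ ∣ U ∣) ((a + b) ^ n) ⟩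
      (a + c * b) ^ ∣ U ∣ * (a + b) ^ suc n ∎
      where M = ∑[ T ⊆ n ] weight T * c ^ miss T U

    -- Markov: P(|T ∩ U| < r) ≤ 2^r E[2^-|T ∩ U|] = 2^r ((a + 2b) / (2(a + b)))^|U|
    ∑-weight*𝟙[hit<r] : ∀ {n} (U : Subset n) r →
      2 ^ ∣ U ∣ * (a + b) ^ ∣ U ∣ * (∑[ T ⊆ n ] weight T * 𝟙[ hit T U < r ]) ≤ 2 ^ r * ((a + 2 * b) ^ ∣ U ∣ * (a + b) ^ n)
    ∑-weight*𝟙[hit<r] {n} U r = begin
      2 ^ ∣ U ∣ * (a + b) ^ ∣ U ∣ * (∑[ T ⊆ n ] weight T * 𝟙[ hit T U < r ])
        ≡⟨ solve 3 (λ t p s → t :* p :* s := p :* (t :* s)) refl (2 ^ ∣ U ∣) ((a + b) ^ ∣ U ∣) _ ⟩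
      (a + b) ^ ∣ U ∣ * (2 ^ ∣ U ∣ * (∑[ T ⊆ n ] weight T * 𝟙[ hit T U < r ]))
        ≡⟨ cong ((a + b) ^ ∣ U ∣ *_) (∑ˢ-*ˡ n (2 ^ ∣ U ∣) _) ⟨
      (a + b) ^ ∣ U ∣ * (∑[ T ⊆ n ] 2 ^ ∣ U ∣ * (weight T * 𝟙[ hit T U < r ]))
        ≤⟨ *-monoʳ-≤ ((a + b) ^ ∣ U ∣) (∑ˢ-mono-≤ n markov) ⟩
      (a + b) ^ ∣ U ∣ * (∑[ T ⊆ n ] 2 ^ r * (weight T * 2 ^ miss T U))
        ≡⟨ cong ((a + b) ^ ∣ U ∣ *_) (∑ˢ-*ˡ n (2 ^ r) _) ⟩
      (a + b) ^ ∣ U ∣ * (2 ^ r * (∑[ T ⊆ n ] weight T * 2 ^ miss T U))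
        ≡⟨ solve 3 (λ p t s → p :* (t :* s) := t :* (s :* p)) refl ((a + b) ^ ∣ U ∣) (2 ^ r) _ ⟩
      2 ^ r * ((∑[ T ⊆ n ] weight T * 2 ^ miss T U) * (a + b) ^ ∣ U ∣)
        ≡⟨ cong (2 ^ r *_) (∑-weight*c^miss 2 U) ⟩
      2 ^ r * ((a + 2 * b) ^ ∣ U ∣ * (a + b) ^ n) ∎
      where
      markov : ∀ T → 2 ^ ∣ U ∣ * (weight T * 𝟙[ hit T U < r ]) ≤ 2 ^ r * (weight T * 2 ^ miss T U)
      markov T = begin
        2 ^ ∣ U ∣ * (weight T * 𝟙[ hit T U < r ])  ≡⟨ x∙yz≈y∙xz (2 ^ ∣ U ∣) (weight T) _ ⟩
        weight T * (2 ^ ∣ U ∣ * 𝟙[ hit T U < r ])  ≤⟨ *-monoʳ-≤ (weight T) (2^∣U∣*𝟙[hit<r]≤2^r*2^miss T U r) ⟩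
        weight T * (2 ^ r * 2 ^ miss T U)          ≡⟨ x∙yz≈y∙xz (weight T) (2 ^ r) _ ⟩
        2 ^ r * (weight T * 2 ^ miss T U)          ∎

module Domination {n : ℕ} (G : Graph n) (k r m′ : ℕ) (1≤r : 1 ℕ.≤ r)
  (ball : ∀ v → AtLeast G (ℕ.suc m′) (InN G k v))
  (S₀ : Subset n) (dom₀ : IsTotalDom G k r S₀) where

  open import Data.Nat using (zero; suc; _+_; _*_; _∸_; _^_; _≤_; _<_; _<?_; _≤?_; z≤n; s≤s)
  open import Data.Nat.Properties
  open import Data.Nat.Solver using (module +-*-Solver)
  open +-*-Solver using (solve; _:+_; _:*_; con; _:=_)
  open import Data.Fin using (Fin)
  open import Data.Fin.Subset using (Subset; _∈_; ∣_∣; ⊥; ⊤; _∪_; _∩_)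
  open import Data.Fin.Subset.Properties using (∣⊥∣≡0; ∣⊤∣≡n; ∈⊤; x∈p∪q⁺; x∈p∩q⁻)
  open import Data.List using (take)
  open import Data.List.Properties using (length-take)
  open import Data.List.Relation.Unary.All as All using (All)
  import Data.List.Relation.Unary.All.Properties as All
  import Data.List.Relation.Unary.Unique.Propositional.Properties as Unique
  open import Algebra.Properties.Semiring.Sum +-*-semiring using (sum-syntax; *-distribˡ-sum)
  open import Algebra.Properties.CommutativeSemigroup *-commutativeSemigroup using (interchange)
  open import Data.Product using (Σ; ∃; _×_; _,_; proj₁; proj₂)
  open import Data.Sum using (inj₁; inj₂)
  open import Data.Empty using (⊥-elim)
  open import Data.Integer using (+_)
  open import Data.Rational using (_/_)
  open import Relation.Binary.PropositionalEquality using (_≡_; refl; sym; trans; cong; cong₂; subst)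
  open import Relation.Nullary using (yes; no)
  open Subsets
  open SubsetSums
  open Rationals using (toℚ-nonNeg; /-nonNeg)
  open import Data.Fin.Subset using (inside; outside)
  open import Data.Vec using ([]; _∷_)
  open LeExpBoundIntro using (LeExpBound-≤; toℚ≤frac; LeExpBound-fromℕ)
  open ≤-Reasoning

  m : ℕ
  m = suc m′

  U : Fin n → Subset n
  U v = fromList (proj₁ (ball v))

  ∣U∣≡m : ∀ v → ∣ U v ∣ ≡ m
  ∣U∣≡m v = let (_ , ∣xs∣≡m , uniq , _) = ball v in trans (∣fromList∣≡length uniq) ∣xs∣≡m

  W : Fin n → Subset n
  W v = fromList (proj₁ (dom₀ v))

  ∣W∣≤r : ∀ v → ∣ W v ∣ ≤ r
  ∣W∣≤r v = let (xs , ∣xs∣≡r , _) = dom₀ v in ≤-trans (∣fromList∣≤length xs) (≤-reflexive ∣xs∣≡r)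

  patch : Subset n → Fin n → Subset n
  patch T v with hit T (U v) <? r
  ... | yes _ = W v
  ... | no  _ = ⊥

  patch-bad : ∀ T v → hit T (U v) < r → patch T v ≡ W v
  patch-bad T v bad with hit T (U v) <? r
  ... | yes _   = refl
  ... | no good = ⊥-elim (good bad)

  ∣patch∣≤ : ∀ T v → ∣ patch T v ∣ ≤ r * 𝟙[ hit T (U v) < r ]
  ∣patch∣≤ T v with hit T (U v) <? r
  ... | yes _ = ≤-trans (∣W∣≤r v) (≤-reflexive (sym (*-identityʳ r)))
  ... | no  _ = ≤-trans (≤-reflexive (∣⊥∣≡0 n)) z≤n

  extend : Subset n → Subset n
  extend T = T ∪ ⋃ᶠ (patch T)

  badCount : Subset n → ℕ
  badCount T = ∑[ v < n ] 𝟙[ hit T (U v) < r ]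

  ∣extend∣≤ : ∀ T → ∣ extend T ∣ ≤ ∣ T ∣ + r * badCount T
  ∣extend∣≤ T = begin
    ∣ T ∪ ⋃ᶠ (patch T) ∣                          ≤⟨ ∣p∪q∣≤∣p∣+∣q∣ T _ ⟩
    ∣ T ∣ + ∣ ⋃ᶠ (patch T) ∣                      ≤⟨ +-monoʳ-≤ ∣ T ∣ (∣⋃ᶠ∣≤∑ (patch T)) ⟩
    ∣ T ∣ + ∑[ v < n ] ∣ patch T v ∣              ≤⟨ +-monoʳ-≤ ∣ T ∣ (∑-mono-≤ (∣patch∣≤ T)) ⟩
    ∣ T ∣ + ∑[ v < n ] (r * 𝟙[ hit T (U v) < r ]) ≡⟨ cong (λ x → ∣ T ∣ + x) (*-distribˡ-sum r (λ v → 𝟙[ hit T (U v) < r ])) ⟨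
    ∣ T ∣ + r * badCount T                         ∎

  extend-dominating : ∀ T → IsTotalDom G k r (extend T)
  extend-dominating T u with hit T (U u) <? r
  ... | yes bad = let (xs , ∣xs∣≡r , uniq , witnesses) = dom₀ u in
    xs , ∣xs∣≡r , uniq , All.tabulate λ x∈xs →
      x∈p∪q⁺ (inj₂ (∈-⋃ᶠ⁺ (patch T) u (subst (_ ∈_) (sym (patch-bad T u bad)) (∈-fromList⁺ x∈xs)))) ,
      proj₂ (All.lookup witnesses x∈xs)
  ... | no good = let (xs , ∣xs∣≡hit , uniq , xs⊆T∩U) = elements (T ∩ U u) in
    take r xs , trans (length-take r xs) (m≤n⇒m⊓n≡m (≤-trans (≮⇒≥ good) (≤-reflexive (sym ∣xs∣≡hit)))) ,
    Unique.take⁺ r uniq , All.take⁺ r (All.map into xs⊆T∩U)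
    where
    into : ∀ {x} → x ∈ T ∩ U u → x ∈ extend T × InN G k u x
    into x∈ = let (x∈T , x∈U) = x∈p∩q⁻ T (U u) x∈ in
      x∈p∪q⁺ (inj₁ x∈T) , All.lookup (proj₂ (proj₂ (proj₂ (ball u)))) (∈-fromList⁻ _ x∈U)

  ^-distribʳ-* : ∀ x y j → (x * y) ^ j ≡ x ^ j * y ^ j
  ^-distribʳ-* x y zero    = refl
  ^-distribʳ-* x y (suc j) = trans (cong ((x * y) *_) (^-distribʳ-* x y j)) (interchange x y (x ^ j) (y ^ j))

  module Sampling (2r<m : 2 * r < m) where

    a b X : ℕ
    a = 2 * r
    b = m ∸ 2 * r
    X = 2 ^ r * (m ∸ r) ^ m

    open Weights a b

    a+b≡m : a + b ≡ m
    a+b≡m = m+[n∸m]≡n (<⇒≤ 2r<m)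

    a+2b≡2[m∸r] : a + 2 * b ≡ 2 * (m ∸ r)
    a+2b≡2[m∸r] = begin-equality
      2 * r + 2 * b       ≡⟨ *-distribˡ-+ 2 r b ⟨
      2 * (r + b)         ≡⟨ cong (2 *_) (m+n∸n≡m (r + b) r) ⟨
      2 * (r + b + r ∸ r) ≡⟨ cong (λ x → 2 * (x ∸ r)) (solve 2 (λ r b → (r :+ b) :+ r := con 2 :* r :+ b) refl r b) ⟩
      2 * (a + b ∸ r)     ≡⟨ cong (λ x → 2 * (x ∸ r)) a+b≡m ⟩
      2 * (m ∸ r)         ∎

    weight-pos : ∀ {l} (T : Subset l) → 0 < weight T
    weight-pos []            = s≤s z≤n
    weight-pos (inside  ∷ T) = *-mono-≤ (≤-trans 1≤r (m≤m+n r (r + 0))) (weight-pos T)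
    weight-pos (outside ∷ T) = *-mono-≤ (m<n⇒0<n∸m 2r<m) (weight-pos T)

    expected-size : m * (∑[ T ⊆ n ] weight T * ∣ T ∣) ≡ n * a * m ^ n
    expected-size = subst (λ s → s * (∑[ T ⊆ n ] weight T * ∣ T ∣) ≡ n * a * s ^ n) a+b≡m (∑-weight*∣T∣ n)

    expected-bad : ∀ v → m ^ m * (∑[ T ⊆ n ] weight T * 𝟙[ hit T (U v) < r ]) ≤ X * m ^ n
    expected-bad v = *-cancelˡ-≤ (2 ^ m) {{m^n≢0 2 m}} (begin
      2 ^ m * (m ^ m * B)                       ≡⟨ *-assoc (2 ^ m) (m ^ m) B ⟨
      2 ^ m * m ^ m * B                         ≡⟨ cong (λ s → 2 ^ s * m ^ s * B) (∣U∣≡m v) ⟨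
      2 ^ ∣ U v ∣ * m ^ ∣ U v ∣ * B             ≡⟨ cong (λ s → 2 ^ ∣ U v ∣ * s ^ ∣ U v ∣ * B) a+b≡m ⟨
      2 ^ ∣ U v ∣ * (a + b) ^ ∣ U v ∣ * B       ≤⟨ ∑-weight*𝟙[hit<r] (U v) r ⟩
      2 ^ r * ((a + 2 * b) ^ ∣ U v ∣ * (a + b) ^ n)
        ≡⟨ cong₂ (λ s t → 2 ^ r * (s ^ t * (a + b) ^ n)) a+2b≡2[m∸r] (∣U∣≡m v) ⟩
      2 ^ r * ((2 * (m ∸ r)) ^ m * (a + b) ^ n) ≡⟨ cong₂ (λ s t → 2 ^ r * (s * t ^ n)) (^-distribʳ-* 2 (m ∸ r) m) a+b≡m ⟩
      2 ^ r * (2 ^ m * (m ∸ r) ^ m * m ^ n)     ≡⟨ solve 4 (λ t u v w → t :* (u :* v :* w) := u :* (t :* v :* w)) refl (2 ^ r) (2 ^ m) ((m ∸ r) ^ m) (m ^ n) ⟩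
      2 ^ m * (X * m ^ n)                       ∎)
      where B = ∑[ T ⊆ n ] weight T * 𝟙[ hit T (U v) < r ]

    expected-badCount : m ^ m * (∑[ T ⊆ n ] weight T * badCount T) ≤ n * (X * m ^ n)
    expected-badCount = begin
      m ^ m * (∑[ T ⊆ n ] weight T * badCount T)
        ≡⟨ cong (m ^ m *_) (∑ˢ-cong n (λ T → *-distribˡ-sum (weight T) (λ v → 𝟙[ hit T (U v) < r ]))) ⟩
      m ^ m * (∑[ T ⊆ n ] ∑[ v < n ] (weight T * 𝟙[ hit T (U v) < r ]))
        ≡⟨ cong (m ^ m *_) (∑ˢ-comm-∑ n n (λ v T → weight T * 𝟙[ hit T (U v) < r ])) ⟩
      m ^ m * ∑[ v < n ] (∑[ T ⊆ n ] weight T * 𝟙[ hit T (U v) < r ])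
        ≡⟨ *-distribˡ-sum (m ^ m) (λ v → ∑[ T ⊆ n ] weight T * 𝟙[ hit T (U v) < r ]) ⟩
      ∑[ v < n ] (m ^ m * (∑[ T ⊆ n ] weight T * 𝟙[ hit T (U v) < r ]))
        ≤⟨ ∑-mono-≤ expected-bad ⟩
      ∑[ v < n ] (X * m ^ n)
        ≡⟨ ∑-const n (X * m ^ n) ⟩
      n * (X * m ^ n) ∎

    good-sample : ∃ λ T → m ^ m * m * (∣ T ∣ + r * badCount T) ≤ m ^ m * (2 * n * r) + m * (n * r) * X
    good-sample = weighted-average n weight (λ T → M * m * (∣ T ∣ + r * badCount T)) bound weight-pos (begin
      ∑[ T ⊆ n ] weight T * (M * m * (∣ T ∣ + r * badCount T))
        ≡⟨ ∑ˢ-cong n (λ T → solve 6 (λ w M m s r c → w :* (M :* m :* (s :+ r :* c)) := M :* m :* (w :* s) :+ m :* r :* M :* (w :* c))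
                                      refl (weight T) M m ∣ T ∣ r (badCount T)) ⟩
      ∑[ T ⊆ n ] (M * m * (weight T * ∣ T ∣) + m * r * M * (weight T * badCount T))
        ≡⟨ trans (∑ˢ-distrib-+ n _ _) (cong₂ _+_ (∑ˢ-*ˡ n (M * m) _) (∑ˢ-*ˡ n (m * r * M) _)) ⟩
      M * m * (∑[ T ⊆ n ] weight T * ∣ T ∣) + m * r * M * (∑[ T ⊆ n ] weight T * badCount T)
        ≡⟨ cong₂ _+_ (trans (*-assoc M m _) (cong (M *_) expected-size)) (*-assoc (m * r) M _) ⟩
      M * (n * a * m ^ n) + m * r * (M * (∑[ T ⊆ n ] weight T * badCount T))
        ≤⟨ +-monoʳ-≤ (M * (n * a * m ^ n)) (*-monoʳ-≤ (m * r) expected-badCount) ⟩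
      M * (n * (2 * r) * m ^ n) + m * r * (n * (X * m ^ n))
        ≡⟨ solve 6 (λ M n r p m X → M :* (n :* (con 2 :* r) :* p) :+ m :* r :* (n :* (X :* p)) := p :* (M :* (con 2 :* n :* r) :+ m :* (n :* r) :* X))
                  refl M n r (m ^ n) m X ⟩
      m ^ n * bound
        ≡⟨ cong (_* bound) (subst (λ s → ∑ˢ n weight ≡ s ^ n) a+b≡m (∑-weight n)) ⟨
      ∑ˢ n weight * bound ∎)
      where
      M = m ^ m
      bound = m ^ m * (2 * n * r) + m * (n * r) * X

  dominating-set : Σ (Subset n) λ S → IsTotalDom G k r S ×
                   LeExpBound (toℚ ∣ S ∣) (frac (2 * n * r) m) (toℚ (n * r)) (+ r / 4)
  dominating-set with m ≤? 2 * r
  ... | yes m≤2r = ⊤ , ⊤-dominating ,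
    LeExpBound-≤ (/-nonNeg r 3) (toℚ-nonNeg (n * r)) (toℚ≤frac {∣ ⊤ {n} ∣} {2 * n * r} {m′} (≤-trans (*-monoʳ-≤ ∣ ⊤ {n} ∣ m≤2r) n*2r≤2nr))
    where
    ⊤-dominating : IsTotalDom G k r ⊤
    ⊤-dominating u = let (xs , ∣xs∣≡r , uniq , witnesses) = dom₀ u in
      xs , ∣xs∣≡r , uniq , All.map (λ (_ , inN) → ∈⊤ , inN) witnesses
    n*2r≤2nr : ∣ ⊤ {n} ∣ * (2 * r) ≤ 2 * n * r
    n*2r≤2nr = ≤-reflexive (trans (cong (_* (2 * r)) (∣⊤∣≡n n)) (solve 2 (λ n r → n :* (con 2 :* r) := con 2 :* n :* r) refl n r))
  ... | no m≰2r = extend T , extend-dominating T , LeExpBound-fromℕ {c = n * r} (≤-trans (m≤m+n r (r + 0)) (<⇒≤ 2r<m)) (begin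
      m ^ m * m * ∣ extend T ∣                       ≤⟨ *-monoʳ-≤ (m ^ m * m) (∣extend∣≤ T) ⟩
      m ^ m * m * (∣ T ∣ + r * badCount T)           ≤⟨ T-good ⟩
      m ^ m * (2 * n * r) + m * (n * r) * X          ∎)
    where
    2r<m = ≰⇒> m≰2r
    open Sampling 2r<m
    T = proj₁ good-sample
    T-good = proj₂ good-sample

open import Defs
open import Data.Nat using (ℕ; _≤_; _^_; _*_; _+_; _∸_)
open import Data.Fin.Subset using (Subset; ∣_∣)
open import Data.Product using (Σ; _×_)

open import Data.Nat using (suc; >-nonZero)
open import Data.Nat.Properties using (m^n>0; ∸-monoˡ-≤)
open import Data.Product using (_,_)
open import Data.Integer using (+_)
open import Data.Rational using (_/_)

total-dominating-set-bound : ∀ {n} (G : Graph n) k r m → 1 ≤ r → 1 ≤ m →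
  (∀ v → AtLeast G m (InN G k v)) → Σ (Subset n) (IsTotalDom G k r) →
  Σ (Subset n) λ S → IsTotalDom G k r S ×
    LeExpBound (toℚ ∣ S ∣) (frac (2 * n * r) m) (toℚ (n * r)) (+ r / 4)
total-dominating-set-bound G k r (suc m′) 1≤r _ ball (S₀ , dom₀) =
  Domination.dominating-set G k r m′ 1≤r ball S₀ dom₀

theorem8 : (k r d n : ℕ) → 1 ≤ k → 1 ≤ r → 2 ≤ d →
    (G : Graph n) → MinDegGe G d → GirthGe G (2 * k + 1) →
    (Σ (Subset n) λ S₀ → IsTotalDom G k r S₀) →
    Σ (Subset n) λ S → IsTotalDom G k r S ×
      LeExpBound (toℚ ∣ S ∣) (frac (2 * n * r) ((d ∸ 1) ^ k)) (toℚ (n * r)) (+ r / 4)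
theorem8 k r d n 1≤k 1≤r 2≤d G minDeg girth dominating =
  total-dominating-set-bound G k r ((d ∸ 1) ^ k) 1≤r 1≤[d∸1]^k
    (NonBacktrackingTree.many-within-distance G minDeg girth 1≤k) dominating
  where
  open NonBacktrackingWalks using (module NonBacktrackingTree)
  1≤[d∸1]^k : 1 ≤ (d ∸ 1) ^ k
  1≤[d∸1]^k = m^n>0 (d ∸ 1) {{>-nonZero (∸-monoˡ-≤ 1 2≤d)}} k
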